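{- We have \[ \begin{pmatrix} EV(x,y,z,1)\\ OD(x,y,z,1)\end{pmatrix}=\frac{1}{\Delta} \begin{pmatrix} -(1+\phi(z,y))f(y,z)-\psi(y,z)g(y,z)\\ (1+\phi(y,z))g(y,z)+\psi(z,y)f(y,z) \end{pmatrix} \] where \[ f(y,z)=\sum_{k=0}^\infty \frac{x^{2k+2} y^{2k+1} z^{4k+3} (yz)^{k(2k+1)}} {(z;\,yz)_{k+1}\,(y z;\,yz)_k}, \qquad g(y,z)=\sum_{k=0}^\infty \frac{x^{2k+1} y^{4k+1} z^{2k} (yz)^{k(2k-1)}} {(y;\,yz)_k\,(y z;\,yz)_k}, \] \[\phi(y,z)= \sum_{k=0}^\infty\frac{x^{2k+2} y^{2k+1} z^{4k+3} (yz)^{k(2k+1)}} {(z;\,yz)_{k+1}\,(y z;\,yz)_{k+1}},\qquad \psi(y,z)= -\sum_{k=0}^\infty\frac{x^{2k+1} y^{2k} z^{4k+1} (yz)^{k(2k-1)}} {(z;\,yz)_{k+1}\,(y z;\,yz)_k}, \] and $\Delta=(1+\phi(y,z))(1+\phi(z,y))-\psi(y,z)\psi(z,y)$ (here $\phi(z,y)$ etc. denote the same expressions with the roles of $y$ and $z$ exchanged).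
   Context: A Catalan word of length $n\geq1$ is a sequence $w_1\cdots w_n$ of nonnegative integers with $w_1=0$ and $w_i\leq w_{i-1}+1$; its Catalan polyomino is the bargraph whose $i$th column has $w_i+1$ cells, columns bottom-aligned. For a Catalan polyomino $P$: $\mathrm{lth}(P)$ = number of columns, $\mathrm{last}(P)$ = number of cells in the last column, $\mathrm{ver}(P)$ = total number of cells in columns of odd index (first column index 1), $\mathrm{white}(P)$ = total number of cells in columns of even index. $EV(x,y,z,u)=\sum x^{\mathrm{lth}(P)}y^{\mathrm{ver}(P)}z^{\mathrm{white}(P)}u^{\mathrm{last}(P)}$ over $P$ with $\mathrm{lth}(P)$ even; $OD$ is the same sum over $P$ with $\mathrm{lth}(P)$ odd. $(a;b)_k=\prod_{j=0}^{k-1}(1-ab^j)$ is the Pochhammer symbol, $(a;b)_0=1$. All series are formal power series in $x$. -}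

module Defs where

open import Data.Nat as ℕ using (ℕ; zero; suc; _∸_; _≡ᵇ_; _≤ᵇ_; _%_)
open import Data.Integer as ℤ using (ℤ; +_)
open import Data.Bool using (Bool; true; false; _∧_; if_then_else_)
open import Relation.Binary.PropositionalEquality using (_≡_)
open import Data.List using (List; []; _∷_; map; concatMap; upTo; filterᵇ; length)

-- Formal power series in x, y, z with integer coefficients.
-- A series F is given by its coefficients: F a b c = [x^a y^b z^c] F.

PS : Set
PS = ℕ → ℕ → ℕ → ℤ

infix 4 _≈_
_≈_ : PS → PS → Set
F ≈ G = ∀ a b c → F a b c ≡ G a b c

sumTo : ℕ → (ℕ → ℤ) → ℤ
sumTo zero    f = f zero
sumTo (suc n) f = sumTo n f ℤ.+ f (suc n)

zeroPS : PS
zeroPS _ _ _ = + 0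

mono : ℕ → ℕ → ℕ → PS
mono p q r a b c = if (a ≡ᵇ p) ∧ (b ≡ᵇ q) ∧ (c ≡ᵇ r) then + 1 else + 0

onePS : PS
onePS = mono 0 0 0

X Y Z : PS
X = mono 1 0 0
Y = mono 0 1 0
Z = mono 0 0 1

infixl 6 _⊕_ _⊖_
infixl 7 _⊛_

_⊕_ : PS → PS → PS
(F ⊕ G) a b c = F a b c ℤ.+ G a b c

⊝_ : PS → PS
(⊝ F) a b c = ℤ.- F a b c

_⊖_ : PS → PS → PS
F ⊖ G = F ⊕ (⊝ G)

_⊛_ : PS → PS → PS
(F ⊛ G) a b c =
  sumTo a (λ i → sumTo b (λ j → sumTo c (λ k →
    F i j k ℤ.* G (a ∸ i) (b ∸ j) (c ∸ k))))

pow : PS → ℕ → PS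
pow F zero    = onePS
pow F (suc m) = F ⊛ pow F m

-- Multiplicative inverse of a series F with constant term 1:
-- 1/F = 1/(1 - (1 - F)) = Σ_{m ≥ 0} (1 - F)^m ; since 1 - F has zero
-- constant term, (1-F)^m contributes nothing to total degree < m, so the
-- coefficient of x^a y^b z^c only needs m ≤ a + b + c.
inv : PS → PS
inv F a b c = sumTo (a ℕ.+ b ℕ.+ c) (λ m → pow (onePS ⊖ F) m a b c)

poch : PS → PS → ℕ → PS
poch A B zero    = onePS
poch A B (suc k) = poch A B k ⊛ (onePS ⊖ A ⊛ pow B k)

-- Formal sum Σ_{k≥0} T k of a family whose k-th term is divisible by x^k
-- (true for all families below: the k-th term is divisible by x^(2k+1)).
-- The coefficient of x^a only receives contributions from k ≤ a.
xSum : (ℕ → PS) → PS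
xSum T a b c = sumTo a (λ k → T k a b c)

swapYZ : PS → PS
swapYZ F a b c = F a c b

YZ : PS
YZ = Y ⊛ Z

fS : PS
fS = xSum λ k →
  mono (2 ℕ.* k ℕ.+ 2) (2 ℕ.* k ℕ.+ 1 ℕ.+ k ℕ.* (2 ℕ.* k ℕ.+ 1))
       (4 ℕ.* k ℕ.+ 3 ℕ.+ k ℕ.* (2 ℕ.* k ℕ.+ 1))
  ⊛ inv (poch Z YZ (suc k)) ⊛ inv (poch YZ YZ k)

gS : PS
gS = xSum λ k →
  mono (2 ℕ.* k ℕ.+ 1) (4 ℕ.* k ℕ.+ 1 ℕ.+ k ℕ.* (2 ℕ.* k ∸ 1))
       (2 ℕ.* k ℕ.+ k ℕ.* (2 ℕ.* k ∸ 1))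
  ⊛ inv (poch Y YZ k) ⊛ inv (poch YZ YZ k)

φS : PS
φS = xSum λ k →
  mono (2 ℕ.* k ℕ.+ 2) (2 ℕ.* k ℕ.+ 1 ℕ.+ k ℕ.* (2 ℕ.* k ℕ.+ 1))
       (4 ℕ.* k ℕ.+ 3 ℕ.+ k ℕ.* (2 ℕ.* k ℕ.+ 1))
  ⊛ inv (poch Z YZ (suc k)) ⊛ inv (poch YZ YZ (suc k))

ψS : PS
ψS = ⊝ (xSum λ k →
  mono (2 ℕ.* k ℕ.+ 1) (2 ℕ.* k ℕ.+ k ℕ.* (2 ℕ.* k ∸ 1))
       (4 ℕ.* k ℕ.+ 1 ℕ.+ k ℕ.* (2 ℕ.* k ∸ 1))
  ⊛ inv (poch Z YZ (suc k)) ⊛ inv (poch YZ YZ k))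

ΔS : PS
ΔS = (onePS ⊕ φS) ⊛ (onePS ⊕ swapYZ φS) ⊖ ψS ⊛ swapYZ ψS

stepsOK : ℕ → List ℕ → Bool
stepsOK prev []       = true
stepsOK prev (v ∷ vs) = (v ≤ᵇ suc prev) ∧ stepsOK v vs

isCatalan : List ℕ → Bool
isCatalan []       = false
isCatalan (w ∷ ws) = (w ≡ᵇ 0) ∧ stepsOK w ws

allSeqs : ℕ → ℕ → List (List ℕ)
allSeqs zero    m = [] ∷ []
allSeqs (suc n) m = concatMap (λ v → map (v ∷_) (allSeqs n m)) (upTo m)

-- all Catalan words of length n (their entries satisfy w_i ≤ i - 1 < n)
catalanWords : ℕ → List (List ℕ)
catalanWords n = filterᵇ isCatalan (allSeqs n n)

-- cells in odd-indexed / even-indexed columns (first column has index 1);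
-- column i of the polyomino of w has w_i + 1 cells
mutual
  oddCells : List ℕ → ℕ
  oddCells []       = 0
  oddCells (w ∷ ws) = suc w ℕ.+ evenCells ws

  evenCells : List ℕ → ℕ
  evenCells []       = 0
  evenCells (w ∷ ws) = oddCells ws

ver white lth : List ℕ → ℕ
ver   = oddCells
white = evenCells
lth   = length

countPoly : ℕ → ℕ → ℕ → ℕ
countPoly a b c =
  length (filterᵇ (λ w → (lth w ≡ᵇ a) ∧ (ver w ≡ᵇ b) ∧ (white w ≡ᵇ c))
                  (catalanWords a))

EV1 : PS
EV1 a b c = if a % 2 ≡ᵇ 0 then + countPoly a b c else + 0

OD1 : PS
OD1 a b c = if a % 2 ≡ᵇ 1 then + countPoly a b c else + 0

{-# OPTIONS --safe #-}
-- Mark the height of the last column of a Catalan polyomino by u and split by the parity of the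
-- length, giving OD(u) and EV(u). Appending a column, whose height is at most one more than that of
-- the previous last column (a geometric sum), gives
--   OD(u)(1 - yu) = xyu(1 - yu) + xyu(EV(1) - yu EV(yu)),   EV(u)(1 - zu) = xzu(OD(1) - zu OD(zu)).
-- With q = yz, composing the two equations expresses OD(q^k) through EV(1), OD(1) and OD(q^(k+1)),
-- and EV(q^k) through OD(1), EV(1) and EV(q^(k+1)). The coefficient of the last term is divisible
-- by x^2, so unrolling from k = 0 converges, to EV(1) = -f - ψ OD(1) - φ EV(1) and
-- OD(1) = g - ψ(z,y) EV(1) - φ(z,y) OD(1); Cramer's rule for this 2×2 system is the theorem.
-- The ring laws for series in x, y, z are inherited from iterated one-variable power series, and
-- infinite sums are controlled by truncating in the degree of x.
module Submission where

open import Algebra.Bundles using (CommutativeRing)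
open import Algebra.Solver.Ring.AlmostCommutativeRing using (fromCommutativeRing; _-Raw-AlmostCommutative⟶_)
open import Data.Bool using (Bool; true; false; _∧_; if_then_else_; not; T)
import Data.Bool.Properties as Bool
open import Data.Integer as ℤ using (ℤ; +_)
import Data.Integer.Properties as ℤ
open import Data.List using (List; []; _∷_; _++_; _∷ʳ_; map; concatMap; upTo; applyUpTo; filterᵇ; length)
import Data.List.Properties as List
open import Data.Maybe using (Maybe; just; nothing)
open import Data.Nat as ℕ using (ℕ; zero; suc; _∸_; _≤_; _<_; z≤n; s≤s; _≡ᵇ_; _≤ᵇ_; _%_)
open import Data.Nat.DivMod using ([m+n]%n≡m%n)
import Data.Nat.Properties as ℕ
open import Data.Nat.Tactic.RingSolver using (solve-∀)
open import Data.Product using (_×_; _,_; proj₁; proj₂)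
open import Function using (Equivalence)
open import Relation.Binary.PropositionalEquality as ≡ using (_≡_; _≢_; refl; cong; cong₂)
open import Relation.Nullary using (yes; no)
open import Relation.Nullary.Decidable using (dec-false)

module PowerSeries {c ℓ} (R : CommutativeRing c ℓ) where
  open CommutativeRing R hiding (zero) renaming (refl to ≈-refl)
  open import Relation.Binary.Reasoning.Setoid setoid

  Σ≤ : ℕ → (ℕ → Carrier) → Carrier
  Σ≤ zero    f = f zero
  Σ≤ (suc n) f = Σ≤ n f + f (suc n)

  Σ≤-cong-≤ : ∀ n {f g : ℕ → Carrier} → (∀ i → i ≤ n → f i ≈ g i) → Σ≤ n f ≈ Σ≤ n g
  Σ≤-cong-≤ zero    f≈g = f≈g zero z≤n
  Σ≤-cong-≤ (suc n) f≈g =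
    +-cong (Σ≤-cong-≤ n (λ i i≤n → f≈g i (ℕ.m≤n⇒m≤1+n i≤n))) (f≈g (suc n) ℕ.≤-refl)

  Σ≤-cong : ∀ n {f g : ℕ → Carrier} → (∀ i → f i ≈ g i) → Σ≤ n f ≈ Σ≤ n g
  Σ≤-cong n f≈g = Σ≤-cong-≤ n (λ i _ → f≈g i)

  Σ≤-distrib-+ : ∀ n (f g : ℕ → Carrier) → Σ≤ n (λ i → f i + g i) ≈ Σ≤ n f + Σ≤ n g
  Σ≤-distrib-+ zero    f g = ≈-refl
  Σ≤-distrib-+ (suc n) f g = begin
    Σ≤ n (λ i → f i + g i) + (f (suc n) + g (suc n))  ≈⟨ +-congʳ (Σ≤-distrib-+ n f g) ⟩
    (Σ≤ n f + Σ≤ n g) + (f (suc n) + g (suc n))        ≈⟨ interchange _ _ _ _ ⟩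
    (Σ≤ n f + f (suc n)) + (Σ≤ n g + g (suc n))        ∎
    where open import Algebra.Properties.CommutativeSemigroup +-commutativeSemigroup using (interchange)

  Σ≤-distribˡ-* : ∀ n x (f : ℕ → Carrier) → x * Σ≤ n f ≈ Σ≤ n (λ i → x * f i)
  Σ≤-distribˡ-* zero    x f = ≈-refl
  Σ≤-distribˡ-* (suc n) x f = trans (distribˡ _ _ _) (+-congʳ (Σ≤-distribˡ-* n x f))

  Σ≤-distribʳ-* : ∀ n x (f : ℕ → Carrier) → Σ≤ n f * x ≈ Σ≤ n (λ i → f i * x)
  Σ≤-distribʳ-* zero    x f = ≈-refl
  Σ≤-distribʳ-* (suc n) x f = trans (distribʳ _ _ _) (+-congʳ (Σ≤-distribʳ-* n x f))

  Σ≤-sucˡ : ∀ n (f : ℕ → Carrier) → Σ≤ (suc n) f ≈ f 0 + Σ≤ n (λ i → f (suc i))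
  Σ≤-sucˡ zero    f = ≈-refl
  Σ≤-sucˡ (suc n) f = trans (+-congʳ (Σ≤-sucˡ n f)) (+-assoc _ _ _)

  Σ≤-head : ∀ n (f : ℕ → Carrier) → (∀ i → f (suc i) ≈ 0#) → Σ≤ n f ≈ f 0
  Σ≤-head zero    f f≈0 = ≈-refl
  Σ≤-head (suc n) f f≈0 = trans (+-cong (Σ≤-head n f f≈0) (f≈0 n)) (+-identityʳ _)

  Σ≤-reverse : ∀ n (f : ℕ → Carrier) → Σ≤ n f ≈ Σ≤ n (λ i → f (n ∸ i))
  Σ≤-reverse zero    f = ≈-refl
  Σ≤-reverse (suc n) f = begin
    Σ≤ (suc n) f                                  ≈⟨ Σ≤-sucˡ n f ⟩
    f 0 + Σ≤ n (λ i → f (suc i))                  ≈⟨ +-comm _ _ ⟩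
    Σ≤ n (λ i → f (suc i)) + f 0                  ≈⟨ +-congʳ (Σ≤-reverse n (λ i → f (suc i))) ⟩
    Σ≤ n (λ i → f (suc (n ∸ i))) + f 0
      ≈⟨ +-cong (Σ≤-cong-≤ n (λ i i≤n → reflexive (cong f (≡.sym (ℕ.+-∸-assoc 1 i≤n)))))
                (reflexive (cong f (≡.sym (ℕ.n∸n≡0 n)))) ⟩
    Σ≤ n (λ i → f (suc n ∸ i)) + f (n ∸ n)        ∎

  Σ≤-triangle : ∀ n (f : ℕ → ℕ → Carrier) →
    Σ≤ n (λ i → Σ≤ (n ∸ i) (λ j → f i j)) ≈ Σ≤ n (λ m → Σ≤ m (λ i → f i (m ∸ i)))
  Σ≤-triangle zero    f = ≈-refl
  Σ≤-triangle (suc n) f = begin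
    Σ≤ (suc n) (λ i → Σ≤ (suc n ∸ i) (f i))
      ≈⟨ Σ≤-sucˡ n _ ⟩
    Σ≤ (suc n) (f 0) + Σ≤ n (λ i → Σ≤ (n ∸ i) (f (suc i)))
      ≈⟨ +-cong (Σ≤-sucˡ n (f 0)) (Σ≤-triangle n (λ i → f (suc i))) ⟩
    (f 0 0 + Σ≤ n (λ m → f 0 (suc m))) + Σ≤ n (λ m → Σ≤ m (λ i → f (suc i) (m ∸ i)))
      ≈⟨ trans (+-assoc _ _ _) (+-congˡ (sym (Σ≤-distrib-+ n _ _))) ⟩
    f 0 0 + Σ≤ n (λ m → f 0 (suc m) + Σ≤ m (λ i → f (suc i) (m ∸ i)))
      ≈⟨ +-congˡ (Σ≤-cong n (λ m → sym (Σ≤-sucˡ m (λ i → f i (suc m ∸ i))))) ⟩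
    f 0 0 + Σ≤ n (λ m → Σ≤ (suc m) (λ i → f i (suc m ∸ i)))
      ≈⟨ sym (Σ≤-sucˡ n _) ⟩
    Σ≤ (suc n) (λ m → Σ≤ m (λ i → f i (m ∸ i)))  ∎

  Ser : Set c
  Ser = ℕ → Carrier

  infix  4 _≋_
  infixl 6 _⊞_
  infixl 7 _⊠_

  _≋_ : Ser → Ser → Set ℓ
  f ≋ g = ∀ n → f n ≈ g n

  _⊞_ : Ser → Ser → Ser
  (f ⊞ g) n = f n + g n

  ⊟_ : Ser → Ser
  (⊟ f) n = - f n

  𝟘 𝟙 : Ser
  𝟘 _       = 0#
  𝟙 zero    = 1#
  𝟙 (suc _) = 0#

  _⊠_ : Ser → Ser → Ser
  (f ⊠ g) n = Σ≤ n (λ i → f i * g (n ∸ i))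

  ⊠-cong : ∀ {f f′ g g′} → f ≋ f′ → g ≋ g′ → f ⊠ g ≋ f′ ⊠ g′
  ⊠-cong f≋f′ g≋g′ n = Σ≤-cong n (λ i → *-cong (f≋f′ i) (g≋g′ (n ∸ i)))

  ⊠-comm : ∀ f g → f ⊠ g ≋ g ⊠ f
  ⊠-comm f g n = begin
    Σ≤ n (λ i → f i * g (n ∸ i))              ≈⟨ Σ≤-reverse n _ ⟩
    Σ≤ n (λ i → f (n ∸ i) * g (n ∸ (n ∸ i)))
      ≈⟨ Σ≤-cong-≤ n (λ i i≤n → trans (*-comm _ _) (*-congʳ (reflexive (cong g (ℕ.m∸[m∸n]≡n i≤n))))) ⟩
    Σ≤ n (λ i → g i * f (n ∸ i))              ∎

  ⊠-assoc : ∀ f g h → (f ⊠ g) ⊠ h ≋ f ⊠ (g ⊠ h)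
  ⊠-assoc f g h n = begin
    Σ≤ n (λ m → Σ≤ m (λ i → f i * g (m ∸ i)) * h (n ∸ m))
      ≈⟨ Σ≤-cong n (λ m → Σ≤-distribʳ-* m _ _) ⟩
    Σ≤ n (λ m → Σ≤ m (λ i → f i * g (m ∸ i) * h (n ∸ m)))
      ≈⟨ Σ≤-cong n (λ m → Σ≤-cong-≤ m (λ i i≤m → *-congˡ (reflexive (cong h (n∸m≡n∸i∸[m∸i] i≤m))))) ⟩
    Σ≤ n (λ m → Σ≤ m (λ i → f i * g (m ∸ i) * h (n ∸ i ∸ (m ∸ i))))
      ≈⟨ sym (Σ≤-triangle n (λ i j → f i * g j * h (n ∸ i ∸ j))) ⟩
    Σ≤ n (λ i → Σ≤ (n ∸ i) (λ j → f i * g j * h (n ∸ i ∸ j)))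
      ≈⟨ Σ≤-cong n (λ i → trans (Σ≤-cong (n ∸ i) (λ j → *-assoc _ _ _)) (sym (Σ≤-distribˡ-* (n ∸ i) _ _))) ⟩
    Σ≤ n (λ i → f i * Σ≤ (n ∸ i) (λ j → g j * h (n ∸ i ∸ j)))  ∎
    where
    n∸m≡n∸i∸[m∸i] : ∀ {m i} → i ≤ m → n ∸ m ≡ n ∸ i ∸ (m ∸ i)
    n∸m≡n∸i∸[m∸i] {m} {i} i≤m =
      ≡.trans (cong (n ∸_) (≡.sym (ℕ.m+[n∸m]≡n i≤m))) (≡.sym (ℕ.∸-+-assoc n i (m ∸ i)))

  ⊠-distribˡ : ∀ f g h → f ⊠ (g ⊞ h) ≋ f ⊠ g ⊞ f ⊠ h
  ⊠-distribˡ f g h n = trans (Σ≤-cong n (λ i → distribˡ _ _ _)) (Σ≤-distrib-+ n _ _)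

  ⊠-identityˡ : ∀ f → 𝟙 ⊠ f ≋ f
  ⊠-identityˡ f zero    = *-identityˡ _
  ⊠-identityˡ f (suc n) = trans (Σ≤-head (suc n) _ (λ i → zeroˡ _)) (*-identityˡ _)

  seriesRing : CommutativeRing c ℓ
  seriesRing = record
    { Carrier = Ser
    ; _≈_ = _≋_
    ; _+_ = _⊞_
    ; _*_ = _⊠_
    ; -_ = ⊟_
    ; 0# = 𝟘
    ; 1# = 𝟙
    ; isCommutativeRing = record
      { isRing = record
        { +-isAbelianGroup = record
          { isGroup = record
            { isMonoid = record
              { isSemigroup = record
                { isMagma = record
                  { isEquivalence = record
                    { refl = λ n → ≈-refl
                    ; sym = λ f≋g n → sym (f≋g n)
                    ; trans = λ f≋g g≋h n → trans (f≋g n) (g≋h n)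
                    }
                  ; ∙-cong = λ f≋f′ g≋g′ n → +-cong (f≋f′ n) (g≋g′ n)
                  }
                ; assoc = λ f g h n → +-assoc _ _ _
                }
              ; identity = (λ f n → +-identityˡ _) , (λ f n → +-identityʳ _)
              }
            ; inverse = (λ f n → -‿inverseˡ _) , (λ f n → -‿inverseʳ _)
            ; ⁻¹-cong = λ f≋g n → -‿cong (f≋g n)
            }
          ; comm = λ f g n → +-comm _ _
          }
        ; *-cong = ⊠-cong
        ; *-assoc = ⊠-assoc
        ; *-identity = ⊠-identityˡ , λ f n → trans (⊠-comm f 𝟙 n) (⊠-identityˡ f n)
        ; distrib = ⊠-distribˡ , λ f g h n →
            trans (⊠-comm (g ⊞ h) f n) (trans (⊠-distribˡ f g h n) (+-cong (⊠-comm f g n) (⊠-comm f h n)))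
        }
      ; *-comm = ⊠-comm
      }
    }

module ListSums {c ℓ} (R : CommutativeRing c ℓ) where
  open CommutativeRing R renaming (refl to ≈-refl)
  open import Relation.Binary.Reasoning.Setoid setoid

  Σ∈ : ∀ {A : Set} → List A → (A → Carrier) → Carrier
  Σ∈ []       Φ = 0#
  Σ∈ (x ∷ xs) Φ = Φ x + Σ∈ xs Φ

  module _ {A : Set} where
    Σ∈-cong : ∀ (xs : List A) {Φ Ψ} → (∀ x → Φ x ≈ Ψ x) → Σ∈ xs Φ ≈ Σ∈ xs Ψ
    Σ∈-cong []       Φ≈Ψ = ≈-refl
    Σ∈-cong (x ∷ xs) Φ≈Ψ = +-cong (Φ≈Ψ x) (Σ∈-cong xs Φ≈Ψ)

    Σ∈-++ : ∀ (xs ys : List A) Φ → Σ∈ (xs ++ ys) Φ ≈ Σ∈ xs Φ + Σ∈ ys Φ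
    Σ∈-++ []       ys Φ = sym (+-identityˡ _)
    Σ∈-++ (x ∷ xs) ys Φ = trans (+-congˡ (Σ∈-++ xs ys Φ)) (sym (+-assoc (Φ x) _ _))

    Σ∈-distribˡ-* : ∀ (xs : List A) F Φ → F * Σ∈ xs Φ ≈ Σ∈ xs (λ x → F * Φ x)
    Σ∈-distribˡ-* []       F Φ = zeroʳ F
    Σ∈-distribˡ-* (x ∷ xs) F Φ = trans (distribˡ F (Φ x) (Σ∈ xs Φ)) (+-congˡ (Σ∈-distribˡ-* xs F Φ))

    Σ∈-distrib-+ : ∀ (xs : List A) Φ Ψ → Σ∈ xs (λ x → Φ x + Ψ x) ≈ Σ∈ xs Φ + Σ∈ xs Ψ
    Σ∈-distrib-+ []       Φ Ψ = sym (+-identityˡ 0#)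
    Σ∈-distrib-+ (x ∷ xs) Φ Ψ = trans (+-congˡ (Σ∈-distrib-+ xs Φ Ψ)) (interchange (Φ x) (Ψ x) _ _)
      where open import Algebra.Properties.CommutativeSemigroup +-commutativeSemigroup using (interchange)

    Σ∈-neg : ∀ (xs : List A) Φ → Σ∈ xs (λ x → - Φ x) ≈ - Σ∈ xs Φ
    Σ∈-neg []       Φ = sym ε⁻¹≈ε
      where open import Algebra.Properties.Group +-group using (ε⁻¹≈ε)
    Σ∈-neg (x ∷ xs) Φ = trans (+-congˡ (Σ∈-neg xs Φ)) (⁻¹-∙-comm (Φ x) (Σ∈ xs Φ))
      where open import Algebra.Properties.AbelianGroup +-abelianGroup using (⁻¹-∙-comm)

    Σ∈-linear : ∀ (xs : List A) r Φ Ψ → Σ∈ xs (λ x → Φ x - r * Ψ x) ≈ Σ∈ xs Φ - r * Σ∈ xs Ψ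
    Σ∈-linear xs r Φ Ψ = begin
      Σ∈ xs (λ x → Φ x - r * Ψ x)          ≈⟨ Σ∈-distrib-+ xs Φ (λ x → - (r * Ψ x)) ⟩
      Σ∈ xs Φ + Σ∈ xs (λ x → - (r * Ψ x))  ≈⟨ +-congˡ (Σ∈-neg xs (λ x → r * Ψ x)) ⟩
      Σ∈ xs Φ - Σ∈ xs (λ x → r * Ψ x)      ≈⟨ +-congˡ (-‿cong (Σ∈-distribˡ-* xs r Ψ)) ⟨
      Σ∈ xs Φ - r * Σ∈ xs Ψ                ∎

    Σ∈-zero : ∀ (xs : List A) Φ → (∀ x → Φ x ≈ 0#) → Σ∈ xs Φ ≈ 0#
    Σ∈-zero []       Φ Φ≈0 = ≈-refl
    Σ∈-zero (x ∷ xs) Φ Φ≈0 = trans (+-cong (Φ≈0 x) (Σ∈-zero xs Φ Φ≈0)) (+-identityˡ 0#)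

    Σ∈-filter : ∀ (xs : List A) p Φ → Σ∈ (filterᵇ p xs) Φ ≈ Σ∈ xs (λ x → if p x then Φ x else 0#)
    Σ∈-filter []       p Φ = ≈-refl
    Σ∈-filter (x ∷ xs) p Φ with p x
    ... | true  = +-congˡ (Σ∈-filter xs p Φ)
    ... | false = trans (Σ∈-filter xs p Φ) (sym (+-identityˡ _))

  Σ∈-map : ∀ {A B : Set} (f : A → B) (xs : List A) Φ → Σ∈ (map f xs) Φ ≈ Σ∈ xs (λ x → Φ (f x))
  Σ∈-map f []       Φ = ≈-refl
  Σ∈-map f (x ∷ xs) Φ = +-congˡ (Σ∈-map f xs Φ)

  Σ∈-concatMap : ∀ {A B : Set} (f : A → List B) (xs : List A) Φ →
    Σ∈ (concatMap f xs) Φ ≈ Σ∈ xs (λ x → Σ∈ (f x) Φ)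
  Σ∈-concatMap f []       Φ = ≈-refl
  Σ∈-concatMap f (x ∷ xs) Φ = trans (Σ∈-++ (f x) (concatMap f xs) Φ) (+-congˡ (Σ∈-concatMap f xs Φ))

  Σ< : ℕ → (ℕ → Carrier) → Carrier
  Σ< zero    h = 0#
  Σ< (suc m) h = h 0 + Σ< m (λ v → h (suc v))

  Σ∈-applyUpTo : ∀ (g : ℕ → ℕ) m h → Σ∈ (applyUpTo g m) h ≈ Σ< m (λ v → h (g v))
  Σ∈-applyUpTo g zero    h = ≈-refl
  Σ∈-applyUpTo g (suc m) h = +-congˡ (Σ∈-applyUpTo (λ v → g (suc v)) m h)

  Σ∈-upTo : ∀ m h → Σ∈ (upTo m) h ≈ Σ< m h
  Σ∈-upTo m h = Σ∈-applyUpTo (λ v → v) m h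

  Σ<-cong : ∀ m {h h′} → (∀ v → h v ≈ h′ v) → Σ< m h ≈ Σ< m h′
  Σ<-cong zero    h≈h′ = ≈-refl
  Σ<-cong (suc m) h≈h′ = +-cong (h≈h′ 0) (Σ<-cong m (λ v → h≈h′ (suc v)))

  Σ<-zero : ∀ m h → (∀ v → h v ≈ 0#) → Σ< m h ≈ 0#
  Σ<-zero zero    h h≈0 = ≈-refl
  Σ<-zero (suc m) h h≈0 = trans (+-cong (h≈0 0) (Σ<-zero m _ (λ v → h≈0 (suc v)))) (+-identityˡ 0#)

  Σ<-distribˡ-* : ∀ m F h → F * Σ< m h ≈ Σ< m (λ v → F * h v)
  Σ<-distribˡ-* zero    F h = zeroʳ F
  Σ<-distribˡ-* (suc m) F h = trans (distribˡ F (h 0) _) (+-congˡ (Σ<-distribˡ-* m F (λ v → h (suc v))))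

  Σ<-≤ᵇ : ∀ L M h → suc L ≤ M → Σ< M (λ v → if v ≤ᵇ L then h v else 0#) ≈ Σ< (suc L) h
  Σ<-≤ᵇ zero    (suc M) h (s≤s _)   = +-congˡ (Σ<-zero M _ (λ v → ≈-refl))
  Σ<-≤ᵇ (suc L) (suc M) h (s≤s L<M) = +-congˡ (trans (Σ<-cong M suc≤ᵇsuc) (Σ<-≤ᵇ L M (λ v → h (suc v)) L<M))
    where
    suc≤ᵇsuc : ∀ v → (if suc v ≤ᵇ suc L then h (suc v) else 0#) ≈ (if v ≤ᵇ L then h (suc v) else 0#)
    suc≤ᵇsuc zero    = ≈-refl
    suc≤ᵇsuc (suc v) = ≈-refl

  Σ∈-upTo-≤ᵇ : ∀ b L M h → (T b → suc L ≤ M) →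
    Σ∈ (upTo M) (λ v → if b ∧ (v ≤ᵇ L) then h v else 0#) ≈ (if b then Σ< (suc L) h else 0#)
  Σ∈-upTo-≤ᵇ false L M h _   = Σ∈-zero (upTo M) _ (λ _ → ≈-refl)
  Σ∈-upTo-≤ᵇ true  L M h L<M = trans (Σ∈-upTo M _) (Σ<-≤ᵇ L M h (L<M _))

open import Defs
open import Data.Nat using (_+_; _*_)

sumTo-cong : ∀ n {f g : ℕ → ℤ} → (∀ i → i ≤ n → f i ≡ g i) → sumTo n f ≡ sumTo n g
sumTo-cong zero    f≡g = f≡g zero z≤n
sumTo-cong (suc n) f≡g = cong₂ ℤ._+_ (sumTo-cong n (λ i i≤n → f≡g i (ℕ.m≤n⇒m≤1+n i≤n))) (f≡g (suc n) ℕ.≤-refl)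

sumTo-distribˡ-* : ∀ n m f → m ℤ.* sumTo n f ≡ sumTo n (λ i → m ℤ.* f i)
sumTo-distribˡ-* zero    m f = refl
sumTo-distribˡ-* (suc n) m f =
  ≡.trans (ℤ.*-distribˡ-+ m (sumTo n f) _) (cong (ℤ._+ (m ℤ.* f (suc n))) (sumTo-distribˡ-* n m f))

sumTo-zero : ∀ n f → (∀ i → i ≤ n → f i ≡ + 0) → sumTo n f ≡ + 0
sumTo-zero zero    f f≡0 = f≡0 0 z≤n
sumTo-zero (suc n) f f≡0 = cong₂ ℤ._+_ (sumTo-zero n f (λ i i≤n → f≡0 i (ℕ.m≤n⇒m≤1+n i≤n))) (f≡0 (suc n) ℕ.≤-refl)

sumTo-sucˡ : ∀ n f → sumTo (suc n) f ≡ f 0 ℤ.+ sumTo n (λ i → f (suc i))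
sumTo-sucˡ zero    f = refl
sumTo-sucˡ (suc n) f = ≡.trans (cong (ℤ._+ f (suc (suc n))) (sumTo-sucˡ n f)) (ℤ.+-assoc (f 0) _ _)

sumTo-head : ∀ n f → (∀ i → f (suc i) ≡ + 0) → sumTo n f ≡ f 0
sumTo-head zero    f f≡0 = refl
sumTo-head (suc n) f f≡0 = ≡.trans (cong₂ ℤ._+_ (sumTo-head n f f≡0) (f≡0 n)) (ℤ.+-identityʳ _)

sumTo-last : ∀ n f → (∀ i → i < n → f i ≡ + 0) → sumTo n f ≡ f n
sumTo-last zero    f f≡0 = refl
sumTo-last (suc n) f f≡0 =
  ≡.trans (cong (ℤ._+ f (suc n)) (sumTo-zero n f (λ i i≤n → f≡0 i (s≤s i≤n)))) (ℤ.+-identityˡ _)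

sumTo-second : ∀ n f → f 0 ≡ + 0 → (∀ i → f (suc (suc i)) ≡ + 0) → sumTo (suc n) f ≡ f 1
sumTo-second n f f0≡0 f≡0 =
  ≡.trans (sumTo-sucˡ n f) (≡.trans (cong₂ ℤ._+_ f0≡0 (sumTo-head n (λ i → f (suc i)) f≡0)) (ℤ.+-identityˡ _))

sumTo-truncate : ∀ {a} N f → a ≤ N → (∀ k → a < k → f k ≡ + 0) → sumTo N f ≡ sumTo a f
sumTo-truncate {a} zero    f z≤n f≡0 = refl
sumTo-truncate {a} (suc N) f a≤N f≡0 with a ℕ.≟ suc N
... | yes refl = refl
... | no a≢N   = ≡.trans (cong₂ ℤ._+_ (sumTo-truncate N f (ℕ.≤-pred a<N) f≡0) (f≡0 (suc N) a<N)) (ℤ.+-identityʳ _)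
  where a<N = ℕ.≤∧≢⇒< a≤N a≢N

sumTo-distrib-+ : ∀ n f g → sumTo n (λ i → f i ℤ.+ g i) ≡ sumTo n f ℤ.+ sumTo n g
sumTo-distrib-+ zero    f g = refl
sumTo-distrib-+ (suc n) f g =
  ≡.trans (cong (ℤ._+ (f (suc n) ℤ.+ g (suc n))) (sumTo-distrib-+ n f g)) (interchange (sumTo n f) (sumTo n g) _ _)
  where open import Algebra.Properties.CommutativeSemigroup ℤ.+-commutativeSemigroup using (interchange)

sumTo-comm : ∀ m n (f : ℕ → ℕ → ℤ) → sumTo m (λ i → sumTo n (f i)) ≡ sumTo n (λ j → sumTo m (λ i → f i j))
sumTo-comm zero    n f = refl
sumTo-comm (suc m) n f = ≡.trans (cong (ℤ._+ sumTo n (f (suc m))) (sumTo-comm m n f))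
  (≡.sym (sumTo-distrib-+ n (λ j → sumTo m (λ i → f i j)) (f (suc m))))

sumTo-neg : ∀ n f → sumTo n (λ k → ℤ.- f k) ≡ ℤ.- sumTo n f
sumTo-neg zero    f = refl
sumTo-neg (suc n) f =
  ≡.trans (cong (ℤ._+ ℤ.- f (suc n)) (sumTo-neg n f)) (≡.sym (ℤ.neg-distrib-+ (sumTo n f) (f (suc n))))

private
  module S³ = PowerSeries (PowerSeries.seriesRing (PowerSeries.seriesRing ℤ.+-*-commutativeRing))
  module S² = PowerSeries (PowerSeries.seriesRing ℤ.+-*-commutativeRing)
  module S¹ = PowerSeries ℤ.+-*-commutativeRing

series³ : CommutativeRing _ _
series³ = S³.seriesRing

private
  module R³ = CommutativeRing series³

open R³ using () renaming (_*_ to _*³_; 1# to 1³)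

S¹-Σ≤≡sumTo : ∀ n f → S¹.Σ≤ n f ≡ sumTo n f
S¹-Σ≤≡sumTo zero    f = refl
S¹-Σ≤≡sumTo (suc n) f = cong (ℤ._+ f (suc n)) (S¹-Σ≤≡sumTo n f)

S²-Σ≤-apply : ∀ n H c → S².Σ≤ n H c ≡ sumTo n (λ i → H i c)
S²-Σ≤-apply zero    H c = refl
S²-Σ≤-apply (suc n) H c = cong (ℤ._+ H (suc n) c) (S²-Σ≤-apply n H c)

S³-Σ≤-apply : ∀ n H b c → S³.Σ≤ n H b c ≡ sumTo n (λ i → H i b c)
S³-Σ≤-apply zero    H b c = refl
S³-Σ≤-apply (suc n) H b c = cong (ℤ._+ H (suc n) b c) (S³-Σ≤-apply n H b c)

⊛≈*³ : ∀ F G → F ⊛ G ≈ F *³ G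
⊛≈*³ F G a b c = ≡.sym (≡.trans (S³-Σ≤-apply a _ b c) (sumTo-cong a (λ i _ →
  ≡.trans (S²-Σ≤-apply b _ c) (sumTo-cong b (λ j _ → S¹-Σ≤≡sumTo c _)))))

onePS≈1³ : onePS ≈ 1³
onePS≈1³ zero    zero    zero    = refl
onePS≈1³ zero    zero    (suc c) = refl
onePS≈1³ zero    (suc b) c       = refl
onePS≈1³ (suc a) zero    c       = refl
onePS≈1³ (suc a) (suc b) c       = refl

module _ where
  open import Relation.Binary.Reasoning.Setoid R³.setoid

  ⊛-cong≈ : ∀ {F F′ G G′} → F ≈ F′ → G ≈ G′ → F ⊛ G ≈ F′ ⊛ G′
  ⊛-cong≈ {F} {F′} {G} {G′} F≈F′ G≈G′ = begin
    F ⊛ G     ≈⟨ ⊛≈*³ F G ⟩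
    F *³ G    ≈⟨ R³.*-cong F≈F′ G≈G′ ⟩
    F′ *³ G′  ≈⟨ ⊛≈*³ F′ G′ ⟨
    F′ ⊛ G′   ∎

  ⊛-comm≈ : ∀ F G → F ⊛ G ≈ G ⊛ F
  ⊛-comm≈ F G = begin
    F ⊛ G   ≈⟨ ⊛≈*³ F G ⟩
    F *³ G  ≈⟨ R³.*-comm F G ⟩
    G *³ F  ≈⟨ ⊛≈*³ G F ⟨
    G ⊛ F   ∎

  ⊛-assoc≈ : ∀ F G H → (F ⊛ G) ⊛ H ≈ F ⊛ (G ⊛ H)
  ⊛-assoc≈ F G H = begin
    (F ⊛ G) ⊛ H     ≈⟨ ⊛≈*³ (F ⊛ G) H ⟩
    (F ⊛ G) *³ H    ≈⟨ R³.*-cong {F ⊛ G} {F *³ G} {H} {H} (⊛≈*³ F G) R³.refl ⟩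
    (F *³ G) *³ H   ≈⟨ R³.*-assoc F G H ⟩
    F *³ (G *³ H)   ≈⟨ R³.*-cong {F} {F} {G ⊛ H} {G *³ H} R³.refl (⊛≈*³ G H) ⟨
    F *³ (G ⊛ H)    ≈⟨ ⊛≈*³ F (G ⊛ H) ⟨
    F ⊛ (G ⊛ H)     ∎

  ⊛-identityˡ≈ : ∀ F → onePS ⊛ F ≈ F
  ⊛-identityˡ≈ F = begin
    onePS ⊛ F   ≈⟨ ⊛≈*³ onePS F ⟩
    onePS *³ F  ≈⟨ R³.*-cong {onePS} {1³} {F} {F} onePS≈1³ R³.refl ⟩
    1³ *³ F     ≈⟨ R³.*-identityˡ F ⟩
    F           ∎

  ⊛-distribˡ≈ : ∀ F G H → F ⊛ (G ⊕ H) ≈ F ⊛ G ⊕ F ⊛ H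
  ⊛-distribˡ≈ F G H = begin
    F ⊛ (G ⊕ H)       ≈⟨ ⊛≈*³ F (G ⊕ H) ⟩
    F *³ (G ⊕ H)      ≈⟨ R³.distribˡ F G H ⟩
    F *³ G ⊕ F *³ H   ≈⟨ R³.+-cong (⊛≈*³ F G) (⊛≈*³ F H) ⟨
    F ⊛ G ⊕ F ⊛ H     ∎

-- Pointwise equality unfolds through ⊛ into integer sums, from which Agda cannot recover the series
-- being compared; wrapping it in a record keeps both sides inferable.
infix 4 _≋_
record _≋_ (F G : PS) : Set where
  constructor wrap
  field unwrap : F ≈ G
open _≋_ public

psRing : CommutativeRing _ _
psRing = record
  { Carrier = PS
  ; _≈_ = _≋_
  ; _+_ = _⊕_
  ; _*_ = _⊛_
  ; -_ = ⊝_
  ; 0# = zeroPS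
  ; 1# = onePS
  ; isCommutativeRing = record
    { isRing = record
      { +-isAbelianGroup = record
        { isGroup = record
          { isMonoid = record
            { isSemigroup = record
              { isMagma = record
                { isEquivalence = record
                  { refl = wrap R³.refl
                  ; sym = λ F≋G → wrap (R³.sym (unwrap F≋G))
                  ; trans = λ F≋G G≋H → wrap (R³.trans (unwrap F≋G) (unwrap G≋H))
                  }
                ; ∙-cong = λ F≋F′ G≋G′ → wrap (R³.+-cong (unwrap F≋F′) (unwrap G≋G′))
                }
              ; assoc = λ F G H → wrap (R³.+-assoc F G H)
              }
            ; identity = (λ F → wrap (R³.+-identityˡ F)) , (λ F → wrap (R³.+-identityʳ F))
            }
          ; inverse = (λ F → wrap (R³.-‿inverseˡ F)) , (λ F → wrap (R³.-‿inverseʳ F))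
          ; ⁻¹-cong = λ F≋G → wrap (R³.-‿cong (unwrap F≋G))
          }
        ; comm = λ F G → wrap (R³.+-comm F G)
        }
      ; *-cong = λ F≋F′ G≋G′ → wrap (⊛-cong≈ (unwrap F≋F′) (unwrap G≋G′))
      ; *-assoc = λ F G H → wrap (⊛-assoc≈ F G H)
      ; *-identity = (λ F → wrap (⊛-identityˡ≈ F))
                   , (λ F → wrap (R³.trans (⊛-comm≈ F onePS) (⊛-identityˡ≈ F)))
      ; distrib = (λ F G H → wrap (⊛-distribˡ≈ F G H))
                , (λ F G H → wrap (R³.trans (⊛-comm≈ (G ⊕ H) F)
                     (R³.trans (⊛-distribˡ≈ F G H) (R³.+-cong (⊛-comm≈ F G) (⊛-comm≈ F H)))))
      }
    ; *-comm = λ F G → wrap (⊛-comm≈ F G)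
    }
  }

module PSR = CommutativeRing psRing

-- Constants for the ring solver; 0 and 1 go to zeroPS and onePS on the nose, so that the solver's
-- normal forms match goals stated with them.
const : ℤ → PS
const (+ 0) = zeroPS
const (+ 1) = onePS
const m     = λ a b c → m ℤ.* onePS a b c

const-≈ : ∀ m → const m ≈ (λ a b c → m ℤ.* onePS a b c)
const-≈ (+ 0)           a b c = ≡.sym (ℤ.*-zeroˡ (onePS a b c))
const-≈ (+ 1)           a b c = ≡.sym (ℤ.*-identityˡ (onePS a b c))
const-≈ (+ suc (suc n)) a b c = refl
const-≈ ℤ.-[1+ n ]      a b c = refl

const-⊛ : ∀ m G → const m ⊛ G ≋ (λ a b c → m ℤ.* G a b c)
const-⊛ m G = wrap λ a b c → ≡.trans (m-factors-out a b c) (cong (m ℤ.*_) (unwrap (PSR.*-identityˡ G) a b c))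
  where
  m-factors-out : ∀ a b c → (const m ⊛ G) a b c ≡ m ℤ.* (onePS ⊛ G) a b c
  m-factors-out a b c = ≡.sym (
    ≡.trans (sumTo-distribˡ-* a m _) (sumTo-cong a (λ i _ →
    ≡.trans (sumTo-distribˡ-* b m _) (sumTo-cong b (λ j _ →
    ≡.trans (sumTo-distribˡ-* c m _) (sumTo-cong c (λ k _ →
    ≡.trans (≡.sym (ℤ.*-assoc m (onePS i j k) _)) (cong (ℤ._* _) (≡.sym (const-≈ m i j k))))))))))

const-homomorphism : ℤ.+-*-rawRing -Raw-AlmostCommutative⟶ fromCommutativeRing psRing
const-homomorphism = record
  { ⟦_⟧ = const
  ; +-homo = λ m n → wrap λ a b c → ≡.trans (const-≈ (m ℤ.+ n) a b c)
      (≡.trans (ℤ.*-distribʳ-+ (onePS a b c) m n) (cong₂ ℤ._+_ (≡.sym (const-≈ m a b c)) (≡.sym (const-≈ n a b c))))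
  ; *-homo = λ m n → wrap λ a b c → ≡.trans (const-≈ (m ℤ.* n) a b c)
      (≡.trans (ℤ.*-assoc m n (onePS a b c))
      (≡.trans (cong (m ℤ.*_) (≡.sym (const-≈ n a b c))) (≡.sym (unwrap (const-⊛ m (const n)) a b c))))
  ; -‿homo = λ m → wrap λ a b c → ≡.trans (const-≈ (ℤ.- m) a b c)
      (≡.trans (≡.sym (ℤ.neg-distribˡ-* m (onePS a b c))) (cong ℤ.-_ (≡.sym (const-≈ m a b c))))
  ; 0-homo = PSR.refl
  ; 1-homo = PSR.refl
  }

const-≟ : ∀ m n → Maybe (const m ≋ const n)
const-≟ m n with m ℤ.≟ n
... | yes refl = just PSR.refl
... | no _     = nothing

open import Algebra.Solver.Ring ℤ.+-*-rawRing (fromCommutativeRing psRing) const-homomorphism const-≟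
  using (solve; _:+_; _:-_; _:*_; :-_; con; _:=_)
open import Relation.Binary.Reasoning.Setoid PSR.setoid

⊛-congˡ : ∀ F {G G′} → G ≋ G′ → F ⊛ G ≋ F ⊛ G′
⊛-congˡ F G≋G′ = PSR.*-cong (PSR.refl {F}) G≋G′

⊛-congʳ : ∀ G {F F′} → F ≋ F′ → F ⊛ G ≋ F′ ⊛ G
⊛-congʳ G F≋F′ = PSR.*-cong F≋F′ (PSR.refl {G})

⊕-congˡ : ∀ F {G G′} → G ≋ G′ → F ⊕ G ≋ F ⊕ G′
⊕-congˡ F G≋G′ = PSR.+-cong (PSR.refl {F}) G≋G′

⊕-congʳ : ∀ G {F F′} → F ≋ F′ → F ⊕ G ≋ F′ ⊕ G
⊕-congʳ G F≋F′ = PSR.+-cong F≋F′ (PSR.refl {G})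

⊝-involutive : ∀ F → ⊝ (⊝ F) ≋ F
⊝-involutive F = solve 1 (λ f → :- (:- f) := f) PSR.refl F

residual-zero : ∀ {F G} → F ≋ G → F ⊖ G ≋ zeroPS
residual-zero {F} {G} F≋G = PSR.trans (⊕-congʳ (⊝ G) F≋G) (PSR.-‿inverseʳ G)

X-⊛-zero : ∀ G b c → (X ⊛ G) 0 b c ≡ + 0
X-⊛-zero G b c = sumTo-zero b _ (λ j _ → sumTo-zero c _ (λ k _ → ℤ.*-zeroˡ (G 0 (b ∸ j) (c ∸ k))))

X-⊛-suc : ∀ G a b c → (X ⊛ G) (suc a) b c ≡ G a b c
X-⊛-suc G a b c =
  ≡.trans (sumTo-second a _ (X-⊛-zero G b c)
             (λ i → sumTo-zero b _ (λ j _ → sumTo-zero c _ (λ k _ → ℤ.*-zeroˡ (G (a ∸ suc i) (b ∸ j) (c ∸ k))))))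
  (≡.trans (sumTo-head b _ (λ j → sumTo-zero c _ (λ k _ → ℤ.*-zeroˡ (G a (b ∸ suc j) (c ∸ k)))))
  (≡.trans (sumTo-head c _ (λ k → ℤ.*-zeroˡ (G a b (c ∸ suc k)))) (ℤ.*-identityˡ (G a b c))))

Y-⊛-zero : ∀ G a c → (Y ⊛ G) a 0 c ≡ + 0
Y-⊛-zero G a c = sumTo-zero a _ (λ i _ → sumTo-zero c _ (λ k _ → Y-coeff i k))
  where
  Y-coeff : ∀ i k → Y i 0 k ℤ.* G (a ∸ i) 0 (c ∸ k) ≡ + 0
  Y-coeff zero    k = ℤ.*-zeroˡ (G a 0 (c ∸ k))
  Y-coeff (suc i) k = ℤ.*-zeroˡ (G (a ∸ suc i) 0 (c ∸ k))

Y-⊛-suc : ∀ G a b c → (Y ⊛ G) a (suc b) c ≡ G a b c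
Y-⊛-suc G a b c =
  ≡.trans (sumTo-head a _ (λ i → sumTo-zero (suc b) _
             (λ j _ → sumTo-zero c _ (λ k _ → ℤ.*-zeroˡ (G (a ∸ suc i) (suc b ∸ j) (c ∸ k))))))
  (≡.trans (sumTo-second b _ (sumTo-zero c _ (λ k _ → ℤ.*-zeroˡ (G a (suc b) (c ∸ k))))
             (λ j → sumTo-zero c _ (λ k _ → ℤ.*-zeroˡ (G a (b ∸ suc j) (c ∸ k)))))
  (≡.trans (sumTo-head c _ (λ k → ℤ.*-zeroˡ (G a b (c ∸ suc k)))) (ℤ.*-identityˡ (G a b c))))

Z-⊛-zero : ∀ G a b → (Z ⊛ G) a b 0 ≡ + 0
Z-⊛-zero G a b = sumTo-zero a _ (λ i _ → sumTo-zero b _ (λ j _ → Z-coeff i j))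
  where
  Z-coeff : ∀ i j → Z i j 0 ℤ.* G (a ∸ i) (b ∸ j) 0 ≡ + 0
  Z-coeff zero    zero    = ℤ.*-zeroˡ (G a b 0)
  Z-coeff zero    (suc j) = ℤ.*-zeroˡ (G a (b ∸ suc j) 0)
  Z-coeff (suc i) j       = ℤ.*-zeroˡ (G (a ∸ suc i) (b ∸ j) 0)

Z-⊛-suc : ∀ G a b c → (Z ⊛ G) a b (suc c) ≡ G a b c
Z-⊛-suc G a b c =
  ≡.trans (sumTo-head a _ (λ i → sumTo-zero b _
             (λ j _ → sumTo-zero (suc c) _ (λ k _ → ℤ.*-zeroˡ (G (a ∸ suc i) (b ∸ j) (suc c ∸ k))))))
  (≡.trans (sumTo-head b _ (λ j → sumTo-zero (suc c) _ (λ k _ → ℤ.*-zeroˡ (G a (b ∸ suc j) (suc c ∸ k)))))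
  (≡.trans (sumTo-second c _ (ℤ.*-zeroˡ (G a b (suc c))) (λ k → ℤ.*-zeroˡ (G a b (c ∸ suc k))))
           (ℤ.*-identityˡ (G a b c))))

mono-cong : ∀ {p q r p′ q′ r′} → p ≡ p′ → q ≡ q′ → r ≡ r′ → mono p q r ≋ mono p′ q′ r′
mono-cong refl refl refl = PSR.refl

mono-sucˣ : ∀ p q r → mono (suc p) q r ≋ X ⊛ mono p q r
mono-sucˣ p q r = wrap λ where
  zero    b c → ≡.sym (X-⊛-zero (mono p q r) b c)
  (suc a) b c → ≡.sym (X-⊛-suc (mono p q r) a b c)

mono-sucʸ : ∀ q r → mono 0 (suc q) r ≋ Y ⊛ mono 0 q r
mono-sucʸ q r = wrap λ where
  zero    zero    c → ≡.sym (Y-⊛-zero (mono 0 q r) 0 c)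
  (suc a) zero    c → ≡.sym (Y-⊛-zero (mono 0 q r) (suc a) c)
  a       (suc b) c → ≡.sym (Y-⊛-suc (mono 0 q r) a b c)

mono-sucᶻ : ∀ r → mono 0 0 (suc r) ≋ Z ⊛ mono 0 0 r
mono-sucᶻ r = wrap λ where
  zero    zero    zero    → ≡.sym (Z-⊛-zero (mono 0 0 r) 0 0)
  zero    (suc b) zero    → ≡.sym (Z-⊛-zero (mono 0 0 r) 0 (suc b))
  (suc a) b       zero    → ≡.sym (Z-⊛-zero (mono 0 0 r) (suc a) b)
  a       b       (suc c) → ≡.sym (Z-⊛-suc (mono 0 0 r) a b c)

pow-cong : ∀ {F G} n → F ≋ G → pow F n ≋ pow G n
pow-cong zero    F≋G = PSR.refl
pow-cong (suc n) F≋G = PSR.*-cong F≋G (pow-cong n F≋G)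

pow-+ : ∀ F m n → pow F (m + n) ≋ pow F m ⊛ pow F n
pow-+ F zero    n = PSR.sym (PSR.*-identityˡ _)
pow-+ F (suc m) n = PSR.trans (⊛-congˡ F (pow-+ F m n)) (PSR.sym (PSR.*-assoc F (pow F m) (pow F n)))

mono≋pow : ∀ p q r → mono p q r ≋ pow X p ⊛ pow Y q ⊛ pow Z r
mono≋pow (suc p) q r = PSR.trans (mono-sucˣ p q r) (PSR.trans (⊛-congˡ X (mono≋pow p q r))
  (solve 4 (λ x a b c → x :* (a :* b :* c) := x :* a :* b :* c) PSR.refl X (pow X p) (pow Y q) (pow Z r)))
mono≋pow zero (suc q) r = PSR.trans (mono-sucʸ q r) (PSR.trans (⊛-congˡ Y (mono≋pow 0 q r))
  (solve 3 (λ y b c → y :* (con (+ 1) :* b :* c) := con (+ 1) :* (y :* b) :* c) PSR.refl Y (pow Y q) (pow Z r)))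
mono≋pow zero zero (suc r) = PSR.trans (mono-sucᶻ r) (PSR.trans (⊛-congˡ Z (mono≋pow 0 0 r))
  (solve 2 (λ z c → z :* (con (+ 1) :* con (+ 1) :* c) := con (+ 1) :* con (+ 1) :* (z :* c)) PSR.refl Z (pow Z r)))
mono≋pow zero zero zero = solve 0 (con (+ 1) := con (+ 1) :* con (+ 1) :* con (+ 1)) PSR.refl

mono-⊛-mono : ∀ p q r p′ q′ r′ → mono p q r ⊛ mono p′ q′ r′ ≋ mono (p + p′) (q + q′) (r + r′)
mono-⊛-mono p q r p′ q′ r′ = begin
  mono p q r ⊛ mono p′ q′ r′
    ≈⟨ PSR.*-cong (mono≋pow p q r) (mono≋pow p′ q′ r′) ⟩
  (pow X p ⊛ pow Y q ⊛ pow Z r) ⊛ (pow X p′ ⊛ pow Y q′ ⊛ pow Z r′)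
    ≈⟨ solve 6 (λ a b c a′ b′ c′ → (a :* b :* c) :* (a′ :* b′ :* c′) := (a :* a′) :* (b :* b′) :* (c :* c′))
         PSR.refl (pow X p) (pow Y q) (pow Z r) (pow X p′) (pow Y q′) (pow Z r′) ⟩
  (pow X p ⊛ pow X p′) ⊛ (pow Y q ⊛ pow Y q′) ⊛ (pow Z r ⊛ pow Z r′)
    ≈⟨ PSR.*-cong (PSR.*-cong (pow-+ X p p′) (pow-+ Y q q′)) (pow-+ Z r r′) ⟨
  pow X (p + p′) ⊛ pow Y (q + q′) ⊛ pow Z (r + r′)
    ≈⟨ mono≋pow _ _ _ ⟨
  mono (p + p′) (q + q′) (r + r′)  ∎

mono-⊛-mono′ : ∀ {F a b c} a′ b′ c′ → F ≋ mono a b c → F ⊛ mono a′ b′ c′ ≋ mono (a + a′) (b + b′) (c + c′)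
mono-⊛-mono′ {F} {a} {b} {c} a′ b′ c′ F≋mono =
  PSR.trans (⊛-congʳ (mono a′ b′ c′) F≋mono) (mono-⊛-mono a b c a′ b′ c′)

pow-mono : ∀ p q r m → pow (mono p q r) m ≋ mono (m * p) (m * q) (m * r)
pow-mono p q r zero    = PSR.refl
pow-mono p q r (suc m) =
  PSR.trans (⊛-congˡ (mono p q r) (pow-mono p q r m)) (mono-⊛-mono p q r (m * p) (m * q) (m * r))

≡ᵇ-false : ∀ {m n} → m ≢ n → (m ≡ᵇ n) ≡ false
≡ᵇ-false {m} {n} m≢n = dec-false (m ℕ.≟ n) m≢n

mono-coeff-≢ : ∀ {p q r a} b c → a ≢ p → mono p q r a b c ≡ + 0
mono-coeff-≢ b c a≢p rewrite ≡ᵇ-false a≢p = refl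

module Graded (w : ℕ → ℕ → ℕ → ℕ)
  (w-split : ∀ {a b c i j k} → i ≤ a → j ≤ b → k ≤ c → w (a ∸ i) (b ∸ j) (c ∸ k) + w i j k ≡ w a b c)
  where

  ord≥ : ℕ → PS → Set
  ord≥ n F = ∀ a b c → w a b c < n → F a b c ≡ + 0

  infix 4 _≈[≤_]_
  _≈[≤_]_ : PS → ℕ → PS → Set
  F ≈[≤ N ] G = ∀ a b c → w a b c ≤ N → F a b c ≡ G a b c

  ord≥-0 : ∀ F → ord≥ 0 F
  ord≥-0 F a b c ()

  ord≥-⊛ : ∀ {F G m n} → ord≥ m F → ord≥ n G → ord≥ (m + n) (F ⊛ G)
  ord≥-⊛ {F} {G} {m} {n} F≥m G≥n a b c wabc<m+n =
    sumTo-zero a _ λ i i≤a → sumTo-zero b _ λ j j≤b → sumTo-zero c _ λ k k≤c → term-zero i≤a j≤b k≤c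
    where
    rest<n : ∀ {i j k} → i ≤ a → j ≤ b → k ≤ c → m ≤ w i j k → w (a ∸ i) (b ∸ j) (c ∸ k) < n
    rest<n {i} {j} {k} i≤a j≤b k≤c m≤wijk = ℕ.+-cancelʳ-< m _ n (ℕ.≤-<-trans (ℕ.+-monoʳ-≤ _ m≤wijk)
      (≡.subst (_< n + m) (≡.sym (w-split i≤a j≤b k≤c)) (≡.subst (w a b c <_) (ℕ.+-comm m n) wabc<m+n)))
    term-zero : ∀ {i j k} → i ≤ a → j ≤ b → k ≤ c → F i j k ℤ.* G (a ∸ i) (b ∸ j) (c ∸ k) ≡ + 0
    term-zero {i} {j} {k} i≤a j≤b k≤c with w i j k ℕ.<? m
    ... | yes wijk<m = ≡.trans (cong (ℤ._* _) (F≥m i j k wijk<m)) (ℤ.*-zeroˡ (G (a ∸ i) (b ∸ j) (c ∸ k)))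
    ... | no wijk≮m  = ≡.trans (cong (F i j k ℤ.*_) (G≥n _ _ _ (rest<n i≤a j≤b k≤c (ℕ.≮⇒≥ wijk≮m))))
                               (ℤ.*-zeroʳ (F i j k))

  ord≥-resp-≋ : ∀ {F G n} → F ≋ G → ord≥ n F → ord≥ n G
  ord≥-resp-≋ F≋G F≥n a b c w<n = ≡.trans (≡.sym (unwrap F≋G a b c)) (F≥n a b c w<n)

  ord≥-⊕ : ∀ {F G n} → ord≥ n F → ord≥ n G → ord≥ n (F ⊕ G)
  ord≥-⊕ F≥n G≥n a b c w<n = cong₂ ℤ._+_ (F≥n a b c w<n) (G≥n a b c w<n)

  ord≥-⊝ : ∀ {F n} → ord≥ n F → ord≥ n (⊝ F)
  ord≥-⊝ F≥n a b c w<n = cong ℤ.-_ (F≥n a b c w<n)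

  ≋⇒≈[≤] : ∀ {F G} N → F ≋ G → F ≈[≤ N ] G
  ≋⇒≈[≤] N F≋G a b c _ = unwrap F≋G a b c

  ≈[≤]-refl : ∀ {F} N → F ≈[≤ N ] F
  ≈[≤]-refl N a b c _ = refl

  ≈[≤]-sym : ∀ {F G N} → F ≈[≤ N ] G → G ≈[≤ N ] F
  ≈[≤]-sym F≈G a b c w≤N = ≡.sym (F≈G a b c w≤N)

  ≈[≤]-trans : ∀ {F G H N} → F ≈[≤ N ] G → G ≈[≤ N ] H → F ≈[≤ N ] H
  ≈[≤]-trans F≈G G≈H a b c w≤N = ≡.trans (F≈G a b c w≤N) (G≈H a b c w≤N)

  ≈[≤]-⊕ : ∀ {F F′ G G′ N} → F ≈[≤ N ] F′ → G ≈[≤ N ] G′ → F ⊕ G ≈[≤ N ] F′ ⊕ G′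
  ≈[≤]-⊕ F≈F′ G≈G′ a b c w≤N = cong₂ ℤ._+_ (F≈F′ a b c w≤N) (G≈G′ a b c w≤N)

  ≈[≤]-⊛ : ∀ {F F′ G G′ N} → F ≈[≤ N ] F′ → G ≈[≤ N ] G′ → F ⊛ G ≈[≤ N ] F′ ⊛ G′
  ≈[≤]-⊛ F≈F′ G≈G′ a b c wabc≤N =
    sumTo-cong a λ i i≤a → sumTo-cong b λ j j≤b → sumTo-cong c λ k k≤c →
      cong₂ ℤ._*_ (F≈F′ i j k (ℕ.≤-trans (ℕ.m≤n+m _ _) (w≤N i≤a j≤b k≤c)))
                  (G≈G′ (a ∸ i) (b ∸ j) (c ∸ k) (ℕ.≤-trans (ℕ.m≤m+n _ _) (w≤N i≤a j≤b k≤c)))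
    where
    w≤N : ∀ {i j k} → i ≤ a → j ≤ b → k ≤ c → w (a ∸ i) (b ∸ j) (c ∸ k) + w i j k ≤ _
    w≤N i≤a j≤b k≤c = ℕ.≤-trans (ℕ.≤-reflexive (w-split i≤a j≤b k≤c)) wabc≤N

  ord≥⇒≈[≤]zeroPS : ∀ {F N} → ord≥ (suc N) F → F ≈[≤ N ] zeroPS
  ord≥⇒≈[≤]zeroPS F≥1+N a b c w≤N = F≥1+N a b c (s≤s w≤N)

  ≈[≤]-all⇒≋ : ∀ {F G} → (∀ N → F ≈[≤ N ] G) → F ≋ G
  ≈[≤]-all⇒≋ F≈G = wrap λ a b c → F≈G (w a b c) a b c ℕ.≤-refl

  ord≥-zeroPS : ∀ n → ord≥ n zeroPS
  ord≥-zeroPS n a b c _ = refl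

module ByXDegree = Graded (λ a _ _ → a) (λ i≤a _ _ → ℕ.m∸n+n≡m i≤a)

+-∸-split₃ : ∀ {a b c i j k} → i ≤ a → j ≤ b → k ≤ c →
  (a ∸ i) + (b ∸ j) + (c ∸ k) + (i + j + k) ≡ a + b + c
+-∸-split₃ {a} {b} {c} {i} {j} {k} i≤a j≤b k≤c =
  ≡.trans (interchange₃ (a ∸ i) (b ∸ j) (c ∸ k) i j k)
          (cong₂ _+_ (cong₂ _+_ (ℕ.m∸n+n≡m i≤a) (ℕ.m∸n+n≡m j≤b)) (ℕ.m∸n+n≡m k≤c))
  where
  interchange₃ : ∀ a b c i j k → a + b + c + (i + j + k) ≡ (a + i) + (b + j) + (c + k)
  interchange₃ = solve-∀

module ByTotalDegree = Graded (λ a b c → a + b + c) +-∸-split₃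

open ByXDegree

open PowerSeries psRing using (Σ≤; Σ≤-distribˡ-*)

Σ≤-apply : ∀ n T a b c → Σ≤ n T a b c ≡ sumTo n (λ k → T k a b c)
Σ≤-apply zero    T a b c = refl
Σ≤-apply (suc n) T a b c = cong (ℤ._+ T (suc n) a b c) (Σ≤-apply n T a b c)

ord≥-mono : ∀ p q r → ord≥ p (mono p q r)
ord≥-mono p q r a b c a<p = mono-coeff-≢ b c (ℕ.<⇒≢ a<p)

ord≥-X : ord≥ 1 X
ord≥-X = ord≥-mono 1 0 0

xSum≈[≤]Σ≤ : ∀ T N → (∀ k → ord≥ k (T k)) → xSum T ≈[≤ N ] Σ≤ N T
xSum≈[≤]Σ≤ T N T≥ a b c a≤N =
  ≡.sym (≡.trans (Σ≤-apply N T a b c) (sumTo-truncate N _ a≤N (λ k a<k → T≥ k a b c a<k)))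

xSum-cong : ∀ {T T′} → (∀ k → T k ≋ T′ k) → xSum T ≋ xSum T′
xSum-cong T≋T′ = wrap λ a b c → sumTo-cong a λ k _ → unwrap (T≋T′ k) a b c

xSum-⊝ : ∀ T → xSum (λ k → ⊝ T k) ≋ ⊝ xSum T
xSum-⊝ T = wrap λ a b c → sumTo-neg a (λ k → T k a b c)

xSum-unique : ∀ {U} T → (∀ k → ord≥ k (T k)) → (∀ N → U ≈[≤ N ] Σ≤ N T) → U ≋ xSum T
xSum-unique T T≥ U≈Σ≤ = ≈[≤]-all⇒≋ λ N → ≈[≤]-trans (U≈Σ≤ N) (≈[≤]-sym (xSum≈[≤]Σ≤ T N T≥))

xSum-⊛ˡ : ∀ F T → (∀ k → ord≥ k (T k)) → F ⊛ xSum T ≋ xSum (λ k → F ⊛ T k)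
xSum-⊛ˡ F T T≥ = xSum-unique (λ k → F ⊛ T k) (λ k → ord≥-⊛ (ord≥-0 F) (T≥ k)) λ N →
  ≈[≤]-trans (≈[≤]-⊛ (≈[≤]-refl {F} N) (xSum≈[≤]Σ≤ T N T≥)) (≋⇒≈[≤] N (Σ≤-distribˡ-* N F T))

xSum-⊕ : ∀ T U → xSum (λ k → T k ⊕ U k) ≋ xSum T ⊕ xSum U
xSum-⊕ T U = wrap λ a b c → sumTo-distrib-+ a (λ k → T k a b c) (λ k → U k a b c)

xSum-suc : ∀ T → (∀ k → ord≥ k (T k)) → xSum T ≋ T 0 ⊕ xSum (λ k → T (suc k))
xSum-suc T T≥ = wrap λ where
  zero    b c → ≡.sym (≡.trans (cong (ℤ._+_ (T 0 0 b c)) (T≥ 1 0 b c (s≤s z≤n))) (ℤ.+-identityʳ _))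
  (suc a) b c → ≡.trans (sumTo-sucˡ a (λ k → T k (suc a) b c)) (cong (ℤ._+_ (T 0 (suc a) b c)) (≡.sym
    (≡.trans (cong (ℤ._+_ (sumTo a (λ k → T (suc k) (suc a) b c))) (T≥ (2 + a) (suc a) b c ℕ.≤-refl)) (ℤ.+-identityʳ _))))

onlyAtZero : PS → ℕ → PS
onlyAtZero F zero    = F
onlyAtZero F (suc _) = zeroPS

xSum-onlyAtZero : ∀ F → xSum (onlyAtZero F) ≋ F
xSum-onlyAtZero F = wrap λ a b c → sumTo-head a (λ k → onlyAtZero F k a b c) (λ k → refl)

xSum-⊖-⊛ : ∀ G T U → (∀ k → ord≥ k (U k)) → xSum (λ k → T k ⊖ G ⊛ U k) ≋ xSum T ⊖ G ⊛ xSum U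
xSum-⊖-⊛ G T U U≥ = begin
  xSum (λ k → T k ⊖ G ⊛ U k)             ≈⟨ xSum-⊕ T (λ k → ⊝ (G ⊛ U k)) ⟩
  xSum T ⊕ xSum (λ k → ⊝ (G ⊛ U k))      ≈⟨ ⊕-congˡ (xSum T) (xSum-⊝ (λ k → G ⊛ U k)) ⟩
  xSum T ⊖ xSum (λ k → G ⊛ U k)          ≈⟨ ⊕-congˡ (xSum T) (PSR.-‿cong (xSum-⊛ˡ G U U≥)) ⟨
  xSum T ⊖ G ⊛ xSum U                    ∎

xSum-⊛ʳ-suc : ∀ F T → (∀ k → ord≥ k (T k)) → T 0 ≋ zeroPS → xSum T ⊛ F ≋ xSum (λ k → T (suc k) ⊛ F)
xSum-⊛ʳ-suc F T T≥ T₀≋0 = begin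
  xSum T ⊛ F                                    ≈⟨ PSR.*-comm (xSum T) F ⟩
  F ⊛ xSum T                                    ≈⟨ xSum-⊛ˡ F T T≥ ⟩
  xSum (λ k → F ⊛ T k)                          ≈⟨ xSum-suc (λ k → F ⊛ T k) (λ k → ord≥-⊛ (ord≥-0 F) (T≥ k)) ⟩
  F ⊛ T 0 ⊕ xSum (λ k → F ⊛ T (suc k))
    ≈⟨ ⊕-congʳ (xSum (λ k → F ⊛ T (suc k))) (PSR.trans (⊛-congˡ F T₀≋0) (PSR.zeroʳ F)) ⟩
  zeroPS ⊕ xSum (λ k → F ⊛ T (suc k))           ≈⟨ PSR.+-identityˡ _ ⟩
  xSum (λ k → F ⊛ T (suc k))                    ≈⟨ xSum-cong (λ k → PSR.*-comm F (T (suc k))) ⟩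
  xSum (λ k → T (suc k) ⊛ F)                    ∎

xSum-linear : ∀ F G T U → (∀ k → ord≥ k (T k)) → (∀ k → ord≥ k (U k)) →
  xSum (λ k → F ⊛ (G ⊛ (T k ⊖ G ⊛ U k))) ≋ F ⊛ (G ⊛ (xSum T ⊖ G ⊛ xSum U))
xSum-linear F G T U T≥ U≥ = PSR.sym (begin
  F ⊛ (G ⊛ (xSum T ⊖ G ⊛ xSum U))             ≈⟨ ⊛-congˡ F (⊛-congˡ G (xSum-⊖-⊛ G T U U≥)) ⟨
  F ⊛ (G ⊛ xSum (λ k → T k ⊖ G ⊛ U k))        ≈⟨ ⊛-congˡ F (xSum-⊛ˡ G _ V≥) ⟩
  F ⊛ xSum (λ k → G ⊛ (T k ⊖ G ⊛ U k))        ≈⟨ xSum-⊛ˡ F _ (λ k → ord≥-⊛ (ord≥-0 G) (V≥ k)) ⟩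
  xSum (λ k → F ⊛ (G ⊛ (T k ⊖ G ⊛ U k)))      ∎)
  where
  V≥ : ∀ k → ord≥ k (T k ⊖ G ⊛ U k)
  V≥ k = ord≥-⊕ (T≥ k) (ord≥-⊝ (ord≥-⊛ (ord≥-0 G) (U≥ k)))

module _ (F : PS) (F₀≡1 : F 0 0 0 ≡ + 1) where
  private
    module Deg = ByTotalDegree

    D : PS
    D = onePS ⊖ F

    D∈𝔪 : Deg.ord≥ 1 D
    D∈𝔪 zero    zero    zero    _ rewrite F₀≡1 = refl
    D∈𝔪 zero    zero    (suc c) (s≤s ())
    D∈𝔪 zero    (suc b) c       (s≤s ())
    D∈𝔪 (suc a) b       c       (s≤s ())

    Dᵐ∈𝔪ᵐ : ∀ m → Deg.ord≥ m (pow D m)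
    Dᵐ∈𝔪ᵐ zero    = Deg.ord≥-0 _
    Dᵐ∈𝔪ᵐ (suc m) = Deg.ord≥-⊛ D∈𝔪 (Dᵐ∈𝔪ᵐ m)

    inv≈partialSum : ∀ N → inv F Deg.≈[≤ N ] Σ≤ N (pow D)
    inv≈partialSum N a b c a+b+c≤N = ≡.sym (≡.trans (Σ≤-apply N (pow D) a b c)
      (sumTo-truncate N _ a+b+c≤N (λ m a+b+c<m → Dᵐ∈𝔪ᵐ m a b c a+b+c<m)))

    ⊛-partialSum : ∀ N → F ⊛ Σ≤ N (pow D) ≋ onePS ⊖ pow D (suc N)
    ⊛-partialSum zero = solve 1 (λ f → f :* con (+ 1) := con (+ 1) :- (con (+ 1) :- f) :* con (+ 1)) PSR.refl F
    ⊛-partialSum (suc N) = begin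
      F ⊛ (Σ≤ N (pow D) ⊕ pow D (suc N))              ≈⟨ PSR.distribˡ F (Σ≤ N (pow D)) (pow D (suc N)) ⟩
      F ⊛ Σ≤ N (pow D) ⊕ F ⊛ pow D (suc N)            ≈⟨ PSR.+-congʳ (⊛-partialSum N) ⟩
      onePS ⊖ pow D (suc N) ⊕ F ⊛ pow D (suc N)
        ≈⟨ solve 2 (λ f p → con (+ 1) :- p :+ f :* p := con (+ 1) :- (con (+ 1) :- f) :* p) PSR.refl F (pow D (suc N)) ⟩
      onePS ⊖ D ⊛ pow D (suc N)                        ∎

  inv-inverseʳ : F ⊛ inv F ≋ onePS
  inv-inverseʳ = wrap λ a b c → let N = a + b + c in
    ≡.trans (Deg.≈[≤]-⊛ (Deg.≈[≤]-refl {F} N) (inv≈partialSum N) a b c ℕ.≤-refl)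
    (≡.trans (unwrap (⊛-partialSum N) a b c)
    (≡.trans (cong (λ v → onePS a b c ℤ.+ ℤ.- v) (Dᵐ∈𝔪ᵐ (suc N) a b c ℕ.≤-refl)) (ℤ.+-identityʳ _)))

  inv-inverseˡ : inv F ⊛ F ≋ onePS
  inv-inverseˡ = PSR.trans (PSR.*-comm (inv F) F) inv-inverseʳ

  solve-by-inv : ∀ {U N} → F ⊛ U ≋ N → U ≋ inv F ⊛ N
  solve-by-inv {U} {N} F⊛U≋N = begin
    U                ≈⟨ PSR.*-identityˡ U ⟨
    onePS ⊛ U        ≈⟨ ⊛-congʳ U inv-inverseˡ ⟨
    (inv F ⊛ F) ⊛ U  ≈⟨ PSR.*-assoc (inv F) F U ⟩
    inv F ⊛ (F ⊛ U)  ≈⟨ ⊛-congˡ (inv F) F⊛U≋N ⟩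
    inv F ⊛ N        ∎

  inv-unique : ∀ G → F ⊛ G ≋ onePS → G ≋ inv F
  inv-unique G F⊛G≋1 = PSR.trans (solve-by-inv F⊛G≋1) (PSR.*-identityʳ (inv F))

inv-cong : ∀ {F F′} → F ≋ F′ → inv F ≋ inv F′
inv-cong F≋F′ = wrap λ a b c → sumTo-cong (a + b + c) λ m _ →
  unwrap (pow-cong m (PSR.+-cong (PSR.refl {onePS}) (PSR.-‿cong F≋F′))) a b c

inv-⊛ : ∀ F G → F 0 0 0 ≡ + 1 → G 0 0 0 ≡ + 1 → inv (F ⊛ G) ≋ inv F ⊛ inv G
inv-⊛ F G F₀≡1 G₀≡1 = PSR.sym (inv-unique (F ⊛ G) (cong₂ ℤ._*_ F₀≡1 G₀≡1) (inv F ⊛ inv G) (begin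
  (F ⊛ G) ⊛ (inv F ⊛ inv G)
    ≈⟨ solve 4 (λ f g a b → (f :* g) :* (a :* b) := (f :* a) :* (g :* b)) PSR.refl F G (inv F) (inv G) ⟩
  (F ⊛ inv F) ⊛ (G ⊛ inv G)  ≈⟨ PSR.*-cong (inv-inverseʳ F F₀≡1) (inv-inverseʳ G G₀≡1) ⟩
  onePS ⊛ onePS              ≈⟨ PSR.*-identityˡ onePS ⟩
  onePS                      ∎))

inv-onePS : inv onePS ≋ onePS
inv-onePS = PSR.sym (inv-unique onePS refl onePS (PSR.*-identityˡ onePS))

geometric : PS → PS
geometric r = inv (onePS ⊖ r)

1⊖-⊛-geometric : ∀ r → r 0 0 0 ≡ + 0 → (onePS ⊖ r) ⊛ geometric r ≋ onePS
1⊖-⊛-geometric r r₀≡0 = inv-inverseʳ (onePS ⊖ r) (cong (λ v → + 1 ℤ.+ ℤ.- v) r₀≡0)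

swapYZ-⊛ : ∀ F G → swapYZ (F ⊛ G) ≋ swapYZ F ⊛ swapYZ G
swapYZ-⊛ F G = wrap λ a b c → sumTo-cong a λ i _ → sumTo-comm c b _

swapYZ-mono : ∀ p q r → swapYZ (mono p q r) ≋ mono p r q
swapYZ-mono p q r = wrap λ a b c →
  cong (λ t → if (a ℕ.≡ᵇ p) ∧ t then + 1 else + 0) (Bool.∧-comm (c ℕ.≡ᵇ q) (b ℕ.≡ᵇ r))

swapYZ-onePS : swapYZ onePS ≋ onePS
swapYZ-onePS = swapYZ-mono 0 0 0

swapYZ-pow : ∀ F n → swapYZ (pow F n) ≋ pow (swapYZ F) n
swapYZ-pow F zero    = swapYZ-onePS
swapYZ-pow F (suc n) = PSR.trans (swapYZ-⊛ F (pow F n)) (⊛-congˡ (swapYZ F) (swapYZ-pow F n))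

swapYZ-inv : ∀ F → swapYZ (inv F) ≋ inv (swapYZ F)
swapYZ-inv F = wrap λ a b c →
  ≡.trans (cong (λ n → sumTo n (λ m → pow (onePS ⊖ F) m a c b)) (xy∙z≈xz∙y a c b))
          (sumTo-cong (a + b + c) λ m _ → unwrap (swapYZ-pow-1⊖ m) a b c)
  where
  open import Algebra.Properties.CommutativeSemigroup ℕ.+-commutativeSemigroup using (xy∙z≈xz∙y)
  swapYZ-pow-1⊖ : ∀ m → swapYZ (pow (onePS ⊖ F) m) ≋ pow (onePS ⊖ swapYZ F) m
  swapYZ-pow-1⊖ m = PSR.trans (swapYZ-pow (onePS ⊖ F) m) (pow-cong m (PSR.+-cong swapYZ-onePS (PSR.refl {⊝ swapYZ F})))

poch-cong : ∀ {A A′ B B′} k → A ≋ A′ → B ≋ B′ → poch A B k ≋ poch A′ B′ k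
poch-cong zero    A≋A′ B≋B′ = PSR.refl
poch-cong (suc k) A≋A′ B≋B′ =
  PSR.*-cong (poch-cong k A≋A′ B≋B′) (PSR.+-cong (PSR.refl {onePS}) (PSR.-‿cong (PSR.*-cong A≋A′ (pow-cong k B≋B′))))

swapYZ-poch : ∀ A B k → swapYZ (poch A B k) ≋ poch (swapYZ A) (swapYZ B) k
swapYZ-poch A B zero    = swapYZ-onePS
swapYZ-poch A B (suc k) = PSR.trans (swapYZ-⊛ (poch A B k) (onePS ⊖ A ⊛ pow B k))
  (PSR.*-cong (swapYZ-poch A B k)
    (PSR.+-cong swapYZ-onePS (PSR.-‿cong (PSR.trans (swapYZ-⊛ A (pow B k)) (⊛-congˡ (swapYZ A) (swapYZ-pow B k))))))

swapYZ-YZ : swapYZ YZ ≋ YZ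
swapYZ-YZ = PSR.trans (swapYZ-⊛ Y Z) (PSR.trans (PSR.*-cong (swapYZ-mono 0 1 0) (swapYZ-mono 0 0 1)) (PSR.*-comm Z Y))

1⊖-constant : ∀ A P → A 0 0 0 ≡ + 0 → (onePS ⊖ A ⊛ P) 0 0 0 ≡ + 1
1⊖-constant A P A₀≡0 = cong (λ v → + 1 ℤ.+ ℤ.- (v ℤ.* P 0 0 0)) A₀≡0

poch-constant : ∀ A B k → A 0 0 0 ≡ + 0 → poch A B k 0 0 0 ≡ + 1
poch-constant A B zero    A₀≡0 = refl
poch-constant A B (suc k) A₀≡0 = cong₂ ℤ._*_ (poch-constant A B k A₀≡0) (1⊖-constant A (pow B k) A₀≡0)

inv-poch-suc : ∀ A B k → A 0 0 0 ≡ + 0 → inv (poch A B (suc k)) ≋ inv (poch A B k) ⊛ inv (onePS ⊖ A ⊛ pow B k)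
inv-poch-suc A B k A₀≡0 =
  inv-⊛ (poch A B k) (onePS ⊖ A ⊛ pow B k) (poch-constant A B k A₀≡0) (1⊖-constant A (pow B k) A₀≡0)

inv-poch-⊛-geometric : ∀ A k {r} → A 0 0 0 ≡ + 0 → A ⊛ pow YZ k ≋ r →
  inv (poch A YZ k) ⊛ geometric r ≋ inv (poch A YZ (suc k))
inv-poch-⊛-geometric A k A₀≡0 A⊛qᵏ≋r = PSR.sym (PSR.trans (inv-poch-suc A YZ k A₀≡0)
  (⊛-congˡ (inv (poch A YZ k)) (inv-cong (⊕-congˡ onePS (PSR.-‿cong A⊛qᵏ≋r)))))

pow-YZ : ∀ k → pow YZ k ≋ mono 0 k k
pow-YZ k = PSR.trans (pow-cong k (mono-⊛-mono 0 1 0 0 0 1))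
  (PSR.trans (pow-mono 0 1 1 k) (mono-cong (ℕ.*-zeroʳ k) (ℕ.*-identityʳ k) (ℕ.*-identityʳ k)))

Y⊛pow-YZ : ∀ k → Y ⊛ pow YZ k ≋ mono 0 (suc k) k
Y⊛pow-YZ k = PSR.trans (⊛-congˡ Y (pow-YZ k)) (mono-⊛-mono 0 1 0 0 k k)

Z⊛pow-YZ : ∀ k → Z ⊛ pow YZ k ≋ mono 0 k (suc k)
Z⊛pow-YZ k = PSR.trans (⊛-congˡ Z (pow-YZ k)) (mono-⊛-mono 0 0 1 0 k k)

YZ⊛pow-YZ : ∀ k → YZ ⊛ pow YZ k ≋ mono 0 (suc k) (suc k)
YZ⊛pow-YZ k = PSR.trans (PSR.*-cong (mono-⊛-mono 0 1 0 0 0 1) (pow-YZ k)) (mono-⊛-mono 0 1 1 0 k k)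

open ListSums psRing

Σ<-geometric : ∀ m r → Σ< m (λ v → pow r (suc v)) ⊛ (onePS ⊖ r) ≋ r ⊖ pow r (suc m)
Σ<-geometric zero    r = solve 1 (λ r → con (+ 0) :* (con (+ 1) :- r) := r :- r :* con (+ 1)) PSR.refl r
Σ<-geometric (suc m) r = begin
  (r ⊛ onePS ⊕ Σ< m (λ v → pow r (suc (suc v)))) ⊛ (onePS ⊖ r)
    ≈⟨ ⊛-congʳ (onePS ⊖ r) (⊕-congˡ (r ⊛ onePS) (Σ<-distribˡ-* m r (λ v → pow r (suc v)))) ⟨
  (r ⊛ onePS ⊕ r ⊛ S) ⊛ (onePS ⊖ r)
    ≈⟨ solve 2 (λ r s → (r :* con (+ 1) :+ r :* s) :* (con (+ 1) :- r)
                         := r :* (con (+ 1) :- r) :+ r :* (s :* (con (+ 1) :- r)))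
         PSR.refl r S ⟩
  r ⊛ (onePS ⊖ r) ⊕ r ⊛ (S ⊛ (onePS ⊖ r))  ≈⟨ ⊕-congˡ (r ⊛ (onePS ⊖ r)) (⊛-congˡ r (Σ<-geometric m r)) ⟩
  r ⊛ (onePS ⊖ r) ⊕ r ⊛ (r ⊖ pow r (suc m))
    ≈⟨ solve 2 (λ r p → r :* (con (+ 1) :- r) :+ r :* (r :- p) := r :- r :* p) PSR.refl r (pow r (suc m)) ⟩
  r ⊖ pow r (suc (suc m))  ∎
  where S = Σ< m (λ v → pow r (suc v))

Σ∈-allSeqs-∷ : ∀ n M Φ → Σ∈ (allSeqs (suc n) M) Φ ≋ Σ∈ (upTo M) (λ v → Σ∈ (allSeqs n M) (λ w → Φ (v ∷ w)))
Σ∈-allSeqs-∷ n M Φ = PSR.trans (Σ∈-concatMap (λ v → map (v ∷_) (allSeqs n M)) (upTo M) Φ)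
  (Σ∈-cong (upTo M) (λ v → Σ∈-map (v ∷_) (allSeqs n M) Φ))

Σ∈-allSeqs-∷ʳ : ∀ n M Φ → Σ∈ (allSeqs (suc n) M) Φ ≋ Σ∈ (allSeqs n M) (λ w → Σ∈ (upTo M) (λ v → Φ (w ∷ʳ v)))
Σ∈-allSeqs-∷ʳ zero M Φ = PSR.trans (Σ∈-allSeqs-∷ zero M Φ)
  (PSR.trans (Σ∈-cong (upTo M) (λ v → PSR.+-identityʳ (Φ (v ∷ [])))) (PSR.sym (PSR.+-identityʳ _)))
Σ∈-allSeqs-∷ʳ (suc n) M Φ = begin
  Σ∈ (allSeqs (suc (suc n)) M) Φ                                      ≈⟨ Σ∈-allSeqs-∷ (suc n) M Φ ⟩
  Σ∈ (upTo M) (λ u → Σ∈ (allSeqs (suc n) M) (λ w → Φ (u ∷ w)))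
    ≈⟨ Σ∈-cong (upTo M) (λ u → Σ∈-allSeqs-∷ʳ n M (λ w → Φ (u ∷ w))) ⟩
  Σ∈ (upTo M) (λ u → Σ∈ (allSeqs n M) (λ w → Σ∈ (upTo M) (λ v → Φ (u ∷ w ∷ʳ v))))
    ≈⟨ Σ∈-allSeqs-∷ n M (λ w → Σ∈ (upTo M) (λ v → Φ (w ∷ʳ v))) ⟨
  Σ∈ (allSeqs (suc n) M) (λ w → Σ∈ (upTo M) (λ v → Φ (w ∷ʳ v)))     ∎

Σ∈-allSeqs-cong : ∀ n M {Φ Ψ} → (∀ w → length w ≡ n → Φ w ≋ Ψ w) → Σ∈ (allSeqs n M) Φ ≋ Σ∈ (allSeqs n M) Ψ
Σ∈-allSeqs-cong zero    M Φ≋Ψ = PSR.+-congʳ (Φ≋Ψ [] refl)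
Σ∈-allSeqs-cong (suc n) M {Φ} {Ψ} Φ≋Ψ = PSR.trans (Σ∈-allSeqs-∷ n M Φ) (PSR.trans
  (Σ∈-cong (upTo M) (λ v → Σ∈-allSeqs-cong n M (λ w |w|≡n → Φ≋Ψ (v ∷ w) (cong suc |w|≡n))))
  (PSR.sym (Σ∈-allSeqs-∷ n M Ψ)))

lastOr : ℕ → List ℕ → ℕ
lastOr p []       = p
lastOr p (x ∷ xs) = lastOr x xs

lastLetter : List ℕ → ℕ
lastLetter = lastOr 0

lastOr-∷ʳ : ∀ p xs v → lastOr p (xs ∷ʳ v) ≡ v
lastOr-∷ʳ p []       v = refl
lastOr-∷ʳ p (x ∷ xs) v = lastOr-∷ʳ x xs v

length-∷ʳ : ∀ (p : List ℕ) v → length (p ∷ʳ v) ≡ suc (length p)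
length-∷ʳ p v = ≡.trans (List.length-++ p) (ℕ.+-comm (length p) 1)

stepsOK-∷ʳ : ∀ p xs v → stepsOK p (xs ∷ʳ v) ≡ stepsOK p xs ∧ (v ≤ᵇ suc (lastOr p xs))
stepsOK-∷ʳ p []       v = Bool.∧-identityʳ _
stepsOK-∷ʳ p (x ∷ xs) v =
  ≡.trans (cong ((x ≤ᵇ suc p) ∧_) (stepsOK-∷ʳ x xs v)) (≡.sym (Bool.∧-assoc (x ≤ᵇ suc p) _ _))

isCatalan-∷ʳ : ∀ x xs v → isCatalan (x ∷ xs ∷ʳ v) ≡ isCatalan (x ∷ xs) ∧ (v ≤ᵇ suc (lastOr x xs))
isCatalan-∷ʳ x xs v = ≡.trans (cong ((x ≡ᵇ 0) ∧_) (stepsOK-∷ʳ x xs v)) (≡.sym (Bool.∧-assoc (x ≡ᵇ 0) _ _))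

stepsOK⇒lastOr≤ : ∀ p xs → T (stepsOK p xs) → lastOr p xs ≤ p + length xs
stepsOK⇒lastOr≤ p []       _  = ℕ.m≤m+n p 0
stepsOK⇒lastOr≤ p (x ∷ xs) ok with Equivalence.to Bool.T-∧ ok
... | x≤1+p , ok′ = ℕ.≤-trans (stepsOK⇒lastOr≤ x xs ok′)
  (ℕ.≤-trans (ℕ.+-monoˡ-≤ (length xs) (ℕ.≤ᵇ⇒≤ x (suc p) x≤1+p)) (ℕ.≤-reflexive (≡.sym (ℕ.+-suc p (length xs)))))

isCatalan⇒lastOr≤ : ∀ x xs → T (isCatalan (x ∷ xs)) → lastOr x xs ≤ length xs
isCatalan⇒lastOr≤ x xs cat with Equivalence.to Bool.T-∧ cat
... | x≡0 , ok with ℕ.≡ᵇ⇒≡ x 0 x≡0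
... | refl = stepsOK⇒lastOr≤ 0 xs ok

catalanWordsBySnoc : ℕ → List (List ℕ)
catalanWordsBySnoc zero          = []
catalanWordsBySnoc (suc zero)    = (0 ∷ []) ∷ []
catalanWordsBySnoc (suc (suc n)) =
  concatMap (λ p → map (p ∷ʳ_) (upTo (2 + lastLetter p))) (catalanWordsBySnoc (suc n))

Σ∈-bySnoc-suc : ∀ n Φ → Σ∈ (catalanWordsBySnoc (2 + n)) Φ ≋
  Σ∈ (catalanWordsBySnoc (suc n)) (λ p → Σ< (2 + lastLetter p) (λ v → Φ (p ∷ʳ v)))
Σ∈-bySnoc-suc n Φ = PSR.trans (Σ∈-concatMap (λ p → map (p ∷ʳ_) (upTo (2 + lastLetter p))) (catalanWordsBySnoc (suc n)) Φ)
  (Σ∈-cong (catalanWordsBySnoc (suc n)) λ p →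
    PSR.trans (Σ∈-map (p ∷ʳ_) (upTo (2 + lastLetter p)) Φ) (Σ∈-upTo (2 + lastLetter p) (λ v → Φ (p ∷ʳ v))))

Σ∈-bySnoc-cong : ∀ n {Φ Ψ} → (∀ w → length w ≡ n → Φ w ≋ Ψ w) →
  Σ∈ (catalanWordsBySnoc n) Φ ≋ Σ∈ (catalanWordsBySnoc n) Ψ
Σ∈-bySnoc-cong zero                Φ≋Ψ = PSR.refl
Σ∈-bySnoc-cong (suc zero)          Φ≋Ψ = ⊕-congʳ zeroPS (Φ≋Ψ (0 ∷ []) refl)
Σ∈-bySnoc-cong (suc (suc n)) {Φ} {Ψ} Φ≋Ψ = PSR.trans (Σ∈-bySnoc-suc n Φ) (PSR.trans
  (Σ∈-bySnoc-cong (suc n) {λ p → Σ< (2 + lastLetter p) (λ v → Φ (p ∷ʳ v))} {λ p → Σ< (2 + lastLetter p) (λ v → Ψ (p ∷ʳ v))}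
     λ p |p|≡1+n → Σ<-cong (2 + lastLetter p) λ v →
     Φ≋Ψ (p ∷ʳ v) (≡.trans (length-∷ʳ p v) (cong suc |p|≡1+n)))
  (PSR.sym (Σ∈-bySnoc-suc n Ψ)))

Σ∈-upTo-catalan-∷ʳ : ∀ M x xs (Φ : List ℕ → PS) → 2 + length xs ≤ M →
  Σ∈ (upTo M) (λ v → if isCatalan (x ∷ xs ∷ʳ v) then Φ (x ∷ xs ∷ʳ v) else zeroPS) ≋
  (if isCatalan (x ∷ xs) then Σ< (2 + lastOr x xs) (λ v → Φ (x ∷ xs ∷ʳ v)) else zeroPS)
Σ∈-upTo-catalan-∷ʳ M x xs Φ 2+|xs|≤M = PSR.trans
  (Σ∈-cong (upTo M) λ v → PSR.reflexive (cong (λ b → if b then Φ (x ∷ xs ∷ʳ v) else zeroPS) (isCatalan-∷ʳ x xs v)))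
  (Σ∈-upTo-≤ᵇ (isCatalan (x ∷ xs)) (suc (lastOr x xs)) M (λ v → Φ (x ∷ xs ∷ʳ v))
    λ cat → ℕ.≤-trans (s≤s (s≤s (isCatalan⇒lastOr≤ x xs cat))) 2+|xs|≤M)

Σ∈-allSeqs-catalan : ∀ n M (Φ : List ℕ → PS) → suc n ≤ M →
  Σ∈ (allSeqs (suc n) M) (λ w → if isCatalan w then Φ w else zeroPS) ≋ Σ∈ (catalanWordsBySnoc (suc n)) Φ
Σ∈-allSeqs-catalan zero (suc M) Φ _ = begin
  Σ∈ (allSeqs 1 (suc M)) (λ w → if isCatalan w then Φ w else zeroPS)
    ≈⟨ Σ∈-allSeqs-∷ zero (suc M) (λ w → if isCatalan w then Φ w else zeroPS) ⟩
  Σ∈ (upTo (suc M)) (λ v → (if isCatalan (v ∷ []) then Φ (v ∷ []) else zeroPS) ⊕ zeroPS)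
    ≈⟨ Σ∈-upTo (suc M) (λ v → (if isCatalan (v ∷ []) then Φ (v ∷ []) else zeroPS) ⊕ zeroPS) ⟩
  (Φ (0 ∷ []) ⊕ zeroPS) ⊕ Σ< M (λ v → zeroPS ⊕ zeroPS)
    ≈⟨ ⊕-congˡ (Φ (0 ∷ []) ⊕ zeroPS) (Σ<-zero M _ (λ v → PSR.+-identityˡ zeroPS)) ⟩
  (Φ (0 ∷ []) ⊕ zeroPS) ⊕ zeroPS
    ≈⟨ PSR.+-identityʳ _ ⟩
  Φ (0 ∷ []) ⊕ zeroPS  ∎
Σ∈-allSeqs-catalan (suc n) M Φ 2+n≤M = begin
  Σ∈ (allSeqs (2 + n) M) (λ w → if isCatalan w then Φ w else zeroPS)
    ≈⟨ Σ∈-allSeqs-∷ʳ (suc n) M _ ⟩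
  Σ∈ (allSeqs (suc n) M) (λ w → Σ∈ (upTo M) (λ v → if isCatalan (w ∷ʳ v) then Φ (w ∷ʳ v) else zeroPS))
    ≈⟨ Σ∈-allSeqs-cong (suc n) M extend ⟩
  Σ∈ (allSeqs (suc n) M) (λ w → if isCatalan w then Ψ w else zeroPS)
    ≈⟨ Σ∈-allSeqs-catalan n M Ψ (ℕ.<⇒≤ 2+n≤M) ⟩
  Σ∈ (catalanWordsBySnoc (suc n)) Ψ
    ≈⟨ Σ∈-bySnoc-suc n Φ ⟨
  Σ∈ (catalanWordsBySnoc (2 + n)) Φ  ∎
  where
  Ψ : List ℕ → PS
  Ψ p = Σ< (2 + lastLetter p) (λ v → Φ (p ∷ʳ v))
  extend : ∀ w → length w ≡ suc n →
    Σ∈ (upTo M) (λ v → if isCatalan (w ∷ʳ v) then Φ (w ∷ʳ v) else zeroPS) ≋ (if isCatalan w then Ψ w else zeroPS)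
  extend (x ∷ xs) |w|≡1+n =
    Σ∈-upTo-catalan-∷ʳ M x xs Φ (≡.subst (λ l → suc (suc l) ≤ M) (≡.sym (ℕ.suc-injective |w|≡1+n)) 2+n≤M)

Σ∈-catalanWords : ∀ n Φ → Σ∈ (catalanWords n) Φ ≋ Σ∈ (catalanWordsBySnoc n) Φ
Σ∈-catalanWords zero    Φ = PSR.refl
Σ∈-catalanWords (suc n) Φ =
  PSR.trans (Σ∈-filter (allSeqs (suc n) (suc n)) isCatalan Φ) (Σ∈-allSeqs-catalan n (suc n) Φ ℕ.≤-refl)

isEven : ℕ → Bool
isEven zero    = true
isEven (suc n) = not (isEven n)

mutual
  oddCells-∷ʳ : ∀ p v → oddCells (p ∷ʳ v) ≡ oddCells p + (if isEven (length p) then suc v else 0)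
  oddCells-∷ʳ []       v = ℕ.+-identityʳ (suc v)
  oddCells-∷ʳ (x ∷ xs) v = ≡.trans (cong (_+_ (suc x)) (evenCells-∷ʳ xs v)) (shift (isEven (length xs)))
    where
    shift : ∀ b → suc x + (evenCells xs + (if b then 0 else suc v))
                ≡ suc x + evenCells xs + (if not b then suc v else 0)
    shift true  = ≡.sym (ℕ.+-assoc (suc x) (evenCells xs) 0)
    shift false = ≡.sym (ℕ.+-assoc (suc x) (evenCells xs) (suc v))

  evenCells-∷ʳ : ∀ p v → evenCells (p ∷ʳ v) ≡ evenCells p + (if isEven (length p) then 0 else suc v)
  evenCells-∷ʳ []       v = refl
  evenCells-∷ʳ (x ∷ xs) v = ≡.trans (oddCells-∷ʳ xs v) (cong (_+_ (oddCells xs)) (shift (isEven (length xs))))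
    where
    shift : ∀ b → (if b then suc v else 0) ≡ (if not b then 0 else suc v)
    shift true  = refl
    shift false = refl

lastCells : List ℕ → ℕ
lastCells w = suc (lastLetter w)

weight : List ℕ → PS
weight w = mono (lth w) (ver w) (white w)

weightᵘ : ℕ → ℕ → List ℕ → PS
weightᵘ s t w = mono (lth w) (ver w + s * lastCells w) (white w + t * lastCells w)

weightᵘ-0-0 : ∀ w → weightᵘ 0 0 w ≋ weight w
weightᵘ-0-0 w = mono-cong refl (ℕ.+-identityʳ (ver w)) (ℕ.+-identityʳ (white w))

weightᵘ≋weight⊛u^last : ∀ s t w → weightᵘ s t w ≋ weight w ⊛ pow (mono 0 s t) (lastCells w)
weightᵘ≋weight⊛u^last s t w = PSR.sym (PSR.trans (⊛-congˡ (weight w) (pow-mono 0 s t (lastCells w)))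
  (PSR.trans (mono-⊛-mono (length w) (ver w) (white w) (h * 0) (h * s) (h * t))
    (mono-cong (+-*-zeroʳ (length w) h) (+-*-comm (ver w) h s) (+-*-comm (white w) h t))))
  where
  h = lastCells w
  +-*-zeroʳ : ∀ l h → l + h * 0 ≡ l
  +-*-zeroʳ = solve-∀
  +-*-comm : ∀ a h s → a + h * s ≡ a + s * h
  +-*-comm = solve-∀

weight⊛X⊛pow : ∀ p v a b → weight p ⊛ X ⊛ pow (mono 0 a b) (suc v) ≋
  mono (length p + 1 + suc v * 0) (ver p + 0 + suc v * a) (white p + 0 + suc v * b)
weight⊛X⊛pow p v a b = PSR.trans (PSR.*-cong (mono-⊛-mono (length p) (ver p) (white p) 1 0 0) (pow-mono 0 a b (suc v)))
  (mono-⊛-mono (length p + 1) (ver p + 0) (white p + 0) (suc v * 0) (suc v * a) (suc v * b))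

length-∷ʳ-+ : ∀ (p : List ℕ) v → length (p ∷ʳ v) ≡ length p + 1 + suc v * 0
length-∷ʳ-+ p v = ≡.trans (length-∷ʳ p v) (suc≡+1 (length p) v)
  where
  suc≡+1 : ∀ l v → suc l ≡ l + 1 + suc v * 0
  suc≡+1 = solve-∀

weightᵘ-∷ʳ-odd : ∀ s t p v → isEven (length p) ≡ true →
  weightᵘ s t (p ∷ʳ v) ≋ weight p ⊛ X ⊛ pow (mono 0 (suc s) t) (suc v)
weightᵘ-∷ʳ-odd s t p v even = PSR.trans (mono-cong (length-∷ʳ-+ p v) odd≡ even≡) (PSR.sym (weight⊛X⊛pow p v (suc s) t))
  where
  odd≡ : oddCells (p ∷ʳ v) + s * suc (lastOr 0 (p ∷ʳ v)) ≡ oddCells p + 0 + suc v * suc s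
  odd≡ rewrite oddCells-∷ʳ p v | even | lastOr-∷ʳ 0 p v = arith (oddCells p) v s
    where
    arith : ∀ o v s → o + suc v + s * suc v ≡ o + 0 + suc v * suc s
    arith = solve-∀
  even≡ : evenCells (p ∷ʳ v) + t * suc (lastOr 0 (p ∷ʳ v)) ≡ evenCells p + 0 + suc v * t
  even≡ rewrite evenCells-∷ʳ p v | even | lastOr-∷ʳ 0 p v = arith (evenCells p) v t
    where
    arith : ∀ e v t → e + 0 + t * suc v ≡ e + 0 + suc v * t
    arith = solve-∀

weightᵘ-∷ʳ-even : ∀ s t p v → isEven (length p) ≡ false →
  weightᵘ s t (p ∷ʳ v) ≋ weight p ⊛ X ⊛ pow (mono 0 s (suc t)) (suc v)
weightᵘ-∷ʳ-even s t p v odd = PSR.trans (mono-cong (length-∷ʳ-+ p v) odd≡ even≡) (PSR.sym (weight⊛X⊛pow p v s (suc t)))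
  where
  odd≡ : oddCells (p ∷ʳ v) + s * suc (lastOr 0 (p ∷ʳ v)) ≡ oddCells p + 0 + suc v * s
  odd≡ rewrite oddCells-∷ʳ p v | odd | lastOr-∷ʳ 0 p v = arith (oddCells p) v s
    where
    arith : ∀ o v s → o + 0 + s * suc v ≡ o + 0 + suc v * s
    arith = solve-∀
  even≡ : evenCells (p ∷ʳ v) + t * suc (lastOr 0 (p ∷ʳ v)) ≡ evenCells p + 0 + suc v * suc t
  even≡ rewrite evenCells-∷ʳ p v | odd | lastOr-∷ʳ 0 p v = arith (evenCells p) v t
    where
    arith : ∀ e v t → e + suc v + t * suc v ≡ e + 0 + suc v * suc t
    arith = solve-∀

Σ<-append-column : ∀ ρ A L →
  (onePS ⊖ ρ) ⊛ Σ< (suc L) (λ v → A ⊛ X ⊛ pow ρ (suc v)) ≋ X ⊛ (ρ ⊛ (A ⊖ ρ ⊛ (A ⊛ pow ρ L)))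
Σ<-append-column ρ A L = begin
  (onePS ⊖ ρ) ⊛ Σ< (suc L) (λ v → A ⊛ X ⊛ pow ρ (suc v))
    ≈⟨ ⊛-congˡ (onePS ⊖ ρ) (Σ<-distribˡ-* (suc L) (A ⊛ X) (λ v → pow ρ (suc v))) ⟨
  (onePS ⊖ ρ) ⊛ (A ⊛ X ⊛ G)
    ≈⟨ solve 4 (λ r a x g → (con (+ 1) :- r) :* (a :* x :* g) := a :* x :* (g :* (con (+ 1) :- r))) PSR.refl ρ A X G ⟩
  A ⊛ X ⊛ (G ⊛ (onePS ⊖ ρ))
    ≈⟨ ⊛-congˡ (A ⊛ X) (Σ<-geometric (suc L) ρ) ⟩
  A ⊛ X ⊛ (ρ ⊖ ρ ⊛ (ρ ⊛ pow ρ L))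
    ≈⟨ solve 4 (λ r a x q → a :* x :* (r :- r :* (r :* q)) := x :* (r :* (a :- r :* (a :* q)))) PSR.refl ρ A X (pow ρ L) ⟩
  X ⊛ (ρ ⊛ (A ⊖ ρ ⊛ (A ⊛ pow ρ L)))  ∎
  where G = Σ< (suc L) (λ v → pow ρ (suc v))

Σ∈-bySnoc-append-column : ∀ n ρ Ψ → (∀ p v → length p ≡ suc n → Ψ (p ∷ʳ v) ≋ weight p ⊛ X ⊛ pow ρ (suc v)) →
  let W = catalanWordsBySnoc (suc n) in
  Σ∈ (catalanWordsBySnoc (2 + n)) Ψ ⊛ (onePS ⊖ ρ) ≋
  X ⊛ (ρ ⊛ (Σ∈ W weight ⊖ ρ ⊛ Σ∈ W (λ p → weight p ⊛ pow ρ (lastCells p))))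
Σ∈-bySnoc-append-column n ρ Ψ Ψ-∷ʳ = begin
  Σ∈ (catalanWordsBySnoc (2 + n)) Ψ ⊛ (onePS ⊖ ρ)  ≈⟨ ⊛-congʳ (onePS ⊖ ρ) (Σ∈-bySnoc-suc n Ψ) ⟩
  Σ∈ W S ⊛ (onePS ⊖ ρ)                            ≈⟨ PSR.*-comm (Σ∈ W S) (onePS ⊖ ρ) ⟩
  (onePS ⊖ ρ) ⊛ Σ∈ W S                            ≈⟨ Σ∈-distribˡ-* W (onePS ⊖ ρ) S ⟩
  Σ∈ W (λ p → (onePS ⊖ ρ) ⊛ S p)                  ≈⟨ Σ∈-bySnoc-cong (suc n) column ⟩
  Σ∈ W (λ p → X ⊛ (ρ ⊛ (weight p ⊖ ρ ⊛ G p)))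
    ≈⟨ PSR.trans (⊛-congˡ X (Σ∈-distribˡ-* W ρ _)) (Σ∈-distribˡ-* W X (λ p → ρ ⊛ (weight p ⊖ ρ ⊛ G p))) ⟨
  X ⊛ (ρ ⊛ Σ∈ W (λ p → weight p ⊖ ρ ⊛ G p))       ≈⟨ ⊛-congˡ X (⊛-congˡ ρ (Σ∈-linear W ρ weight G)) ⟩
  X ⊛ (ρ ⊛ (Σ∈ W weight ⊖ ρ ⊛ Σ∈ W G))            ∎
  where
  W = catalanWordsBySnoc (suc n)
  S G : List ℕ → PS
  S p = Σ< (2 + lastLetter p) (λ v → Ψ (p ∷ʳ v))
  G p = weight p ⊛ pow ρ (lastCells p)
  column : ∀ p → length p ≡ suc n → (onePS ⊖ ρ) ⊛ S p ≋ X ⊛ (ρ ⊛ (weight p ⊖ ρ ⊛ G p))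
  column p |p|≡1+n = PSR.trans (⊛-congˡ (onePS ⊖ ρ) (Σ<-cong (2 + lastLetter p) (λ v → Ψ-∷ʳ p v |p|≡1+n)))
                               (Σ<-append-column ρ (weight p) (lastCells p))

layer : ℕ → ℕ → ℕ → PS
layer n s t = Σ∈ (catalanWordsBySnoc n) (weightᵘ s t)

oddLayer evenLayer : ℕ → ℕ → ℕ → PS
oddLayer  n s t = if isEven n then zeroPS else layer n s t
evenLayer n s t = if isEven n then layer n s t else zeroPS

-- OD(x,y,z,u) and EV(x,y,z,u) at u = y^s z^t.
ODᵘ EVᵘ : ℕ → ℕ → PS
ODᵘ s t = xSum (λ n → oddLayer n s t)
EVᵘ s t = xSum (λ n → evenLayer n s t)

layer-step : ∀ n s t s′ t′ → let ρ = mono 0 s′ t′ in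
  (∀ p v → length p ≡ suc n → weightᵘ s t (p ∷ʳ v) ≋ weight p ⊛ X ⊛ pow ρ (suc v)) →
  layer (2 + n) s t ⊛ (onePS ⊖ ρ) ≋ X ⊛ (ρ ⊛ (layer (suc n) 0 0 ⊖ ρ ⊛ layer (suc n) s′ t′))
layer-step n s t s′ t′ weightᵘ-∷ʳ = PSR.trans (Σ∈-bySnoc-append-column n ρ (weightᵘ s t) weightᵘ-∷ʳ)
  (⊛-congˡ X (⊛-congˡ ρ (PSR.+-cong
    (PSR.sym (Σ∈-bySnoc-cong (suc n) (λ p _ → weightᵘ-0-0 p)))
    (PSR.-‿cong (⊛-congˡ ρ (PSR.sym (Σ∈-bySnoc-cong (suc n) (λ p _ → weightᵘ≋weight⊛u^last s′ t′ p))))))))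
  where ρ = mono 0 s′ t′

empty-layer-step : ∀ r → zeroPS ⊛ (onePS ⊖ r) ≋ X ⊛ (r ⊛ (zeroPS ⊖ r ⊛ zeroPS))
empty-layer-step r =
  solve 2 (λ x r → con (+ 0) :* (con (+ 1) :- r) := x :* (r :* (con (+ 0) :- r :* con (+ 0)))) PSR.refl X r

oddLayer-step : ∀ s t n → oddLayer (2 + n) s t ⊛ (onePS ⊖ mono 0 (suc s) t) ≋
  X ⊛ (mono 0 (suc s) t ⊛ (evenLayer (suc n) 0 0 ⊖ mono 0 (suc s) t ⊛ evenLayer (suc n) (suc s) t))
oddLayer-step s t n with isEven (suc n) in even
... | true  = layer-step n s t (suc s) t
                (λ p v |p|≡1+n → weightᵘ-∷ʳ-odd s t p v (≡.trans (cong isEven |p|≡1+n) even))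
... | false = empty-layer-step (mono 0 (suc s) t)

evenLayer-step : ∀ s t n → evenLayer (2 + n) s t ⊛ (onePS ⊖ mono 0 s (suc t)) ≋
  X ⊛ (mono 0 s (suc t) ⊛ (oddLayer (suc n) 0 0 ⊖ mono 0 s (suc t) ⊛ oddLayer (suc n) s (suc t)))
evenLayer-step s t n with isEven (suc n) in even
... | false = layer-step n s t s (suc t)
                (λ p v |p|≡1+n → weightᵘ-∷ʳ-even s t p v (≡.trans (cong isEven |p|≡1+n) even))
... | true  = empty-layer-step (mono 0 s (suc t))

ord≥-Σ∈ : ∀ {A : Set} (xs : List A) Φ {k} → (∀ x → ord≥ k (Φ x)) → ord≥ k (Σ∈ xs Φ)
ord≥-Σ∈ []       Φ Φ≥k = ord≥-zeroPS _
ord≥-Σ∈ (x ∷ xs) Φ Φ≥k = ord≥-⊕ (Φ≥k x) (ord≥-Σ∈ xs Φ Φ≥k)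

ord≥-layer : ∀ n s t → ord≥ n (layer n s t)
ord≥-layer n s t = ord≥-resp-≋ (PSR.sym (Σ∈-bySnoc-cong n (λ w |w|≡n → mono-cong |w|≡n refl refl)))
  (ord≥-Σ∈ (catalanWordsBySnoc n) _ (λ w → ord≥-mono n _ _))

ord≥-oddLayer : ∀ s t n → ord≥ n (oddLayer n s t)
ord≥-oddLayer s t n with isEven n
... | true  = ord≥-zeroPS n
... | false = ord≥-layer n s t

ord≥-evenLayer : ∀ s t n → ord≥ n (evenLayer n s t)
ord≥-evenLayer s t n with isEven n
... | true  = ord≥-layer n s t
... | false = ord≥-zeroPS n

layer-1 : ∀ s t → layer 1 s t ≋ X ⊛ mono 0 (suc s) t
layer-1 s t = PSR.trans (PSR.+-identityʳ (weightᵘ s t (0 ∷ [])))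
  (PSR.trans (mono-cong refl (cong suc (ℕ.*-identityʳ s)) (ℕ.*-identityʳ t)) (PSR.sym (mono-⊛-mono 1 0 0 0 (suc s) t)))

oddLayer-suc : ∀ s t n → let r = mono 0 (suc s) t in
  oddLayer (suc n) s t ⊛ (onePS ⊖ r) ≋
  onlyAtZero (X ⊛ (r ⊛ (onePS ⊖ r))) n ⊕ X ⊛ (r ⊛ (evenLayer n 0 0 ⊖ r ⊛ evenLayer n (suc s) t))
oddLayer-suc s t zero = PSR.trans (⊛-congʳ (onePS ⊖ r) (layer-1 s t))
  (solve 2 (λ x r → (x :* r) :* (con (+ 1) :- r)
                    := x :* (r :* (con (+ 1) :- r)) :+ x :* (r :* (con (+ 0) :- r :* con (+ 0))))
     PSR.refl X r)
  where r = mono 0 (suc s) t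
oddLayer-suc s t (suc n) = PSR.trans (oddLayer-step s t n) (PSR.sym (PSR.+-identityˡ _))

evenLayer-suc : ∀ s t n → let r = mono 0 s (suc t) in
  evenLayer (suc n) s t ⊛ (onePS ⊖ r) ≋ X ⊛ (r ⊛ (oddLayer n 0 0 ⊖ r ⊛ oddLayer n s (suc t)))
evenLayer-suc s t zero    = empty-layer-step (mono 0 s (suc t))
evenLayer-suc s t (suc n) = evenLayer-step s t n

OD-equation : ∀ s t → let r = mono 0 (suc s) t in
  ODᵘ s t ⊛ (onePS ⊖ r) ≋ X ⊛ (r ⊛ (onePS ⊖ r)) ⊕ X ⊛ (r ⊛ (EVᵘ 0 0 ⊖ r ⊛ EVᵘ (suc s) t))
OD-equation s t = begin
  ODᵘ s t ⊛ (onePS ⊖ r)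
    ≈⟨ xSum-⊛ʳ-suc (onePS ⊖ r) (λ n → oddLayer n s t) (ord≥-oddLayer s t) PSR.refl ⟩
  xSum (λ n → oddLayer (suc n) s t ⊛ (onePS ⊖ r))
    ≈⟨ xSum-cong (oddLayer-suc s t) ⟩
  xSum (λ n → onlyAtZero A n ⊕ X ⊛ (r ⊛ (evenLayer n 0 0 ⊖ r ⊛ evenLayer n (suc s) t)))
    ≈⟨ xSum-⊕ (onlyAtZero A) _ ⟩
  xSum (onlyAtZero A) ⊕ xSum (λ n → X ⊛ (r ⊛ (evenLayer n 0 0 ⊖ r ⊛ evenLayer n (suc s) t)))
    ≈⟨ PSR.+-cong (xSum-onlyAtZero A) (xSum-linear X r _ _ (ord≥-evenLayer 0 0) (ord≥-evenLayer (suc s) t)) ⟩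
  A ⊕ X ⊛ (r ⊛ (EVᵘ 0 0 ⊖ r ⊛ EVᵘ (suc s) t))  ∎
  where
  r = mono 0 (suc s) t
  A = X ⊛ (r ⊛ (onePS ⊖ r))

EV-equation : ∀ s t → let r = mono 0 s (suc t) in
  EVᵘ s t ⊛ (onePS ⊖ r) ≋ X ⊛ (r ⊛ (ODᵘ 0 0 ⊖ r ⊛ ODᵘ s (suc t)))
EV-equation s t = begin
  EVᵘ s t ⊛ (onePS ⊖ r)
    ≈⟨ xSum-⊛ʳ-suc (onePS ⊖ r) (λ n → evenLayer n s t) (ord≥-evenLayer s t) PSR.refl ⟩
  xSum (λ n → evenLayer (suc n) s t ⊛ (onePS ⊖ r))
    ≈⟨ xSum-cong (evenLayer-suc s t) ⟩
  xSum (λ n → X ⊛ (r ⊛ (oddLayer n 0 0 ⊖ r ⊛ oddLayer n s (suc t))))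
    ≈⟨ xSum-linear X r _ _ (ord≥-oddLayer 0 0) (ord≥-oddLayer s (suc t)) ⟩
  X ⊛ (r ⊛ (ODᵘ 0 0 ⊖ r ⊛ ODᵘ s (suc t)))  ∎
  where r = mono 0 s (suc t)

≡ᵇ-comm : ∀ m n → (m ≡ᵇ n) ≡ (n ≡ᵇ m)
≡ᵇ-comm zero    zero    = refl
≡ᵇ-comm zero    (suc n) = refl
≡ᵇ-comm (suc m) zero    = refl
≡ᵇ-comm (suc m) (suc n) = ≡ᵇ-comm m n

weight-coeff : ∀ w a b c → weight w a b c ≡ (if (lth w ≡ᵇ a) ∧ (ver w ≡ᵇ b) ∧ (white w ≡ᵇ c) then + 1 else + 0)
weight-coeff w a b c = cong (λ β → if β then + 1 else + 0)
  (cong₂ _∧_ (≡ᵇ-comm a (lth w)) (cong₂ _∧_ (≡ᵇ-comm b (ver w)) (≡ᵇ-comm c (white w))))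

Σ∈-weight-count : ∀ a b c L → Σ∈ L weight a b c ≡
  + length (filterᵇ (λ w → (lth w ≡ᵇ a) ∧ (ver w ≡ᵇ b) ∧ (white w ≡ᵇ c)) L)
Σ∈-weight-count a b c []      = refl
Σ∈-weight-count a b c (w ∷ L) with (lth w ≡ᵇ a) ∧ (ver w ≡ᵇ b) ∧ (white w ≡ᵇ c) in matches
... | true  = cong₂ ℤ._+_ (≡.trans (weight-coeff w a b c) (cong (λ β → if β then + 1 else + 0) matches))
                         (Σ∈-weight-count a b c L)
... | false = cong₂ ℤ._+_ (≡.trans (weight-coeff w a b c) (cong (λ β → if β then + 1 else + 0) matches))
                         (Σ∈-weight-count a b c L)

layer-coeff : ∀ a b c → layer a 0 0 a b c ≡ + countPoly a b c
layer-coeff a b c = ≡.trans (unwrap (Σ∈-bySnoc-cong a (λ w _ → weightᵘ-0-0 w)) a b c)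
  (≡.trans (≡.sym (unwrap (Σ∈-catalanWords a weight) a b c)) (Σ∈-weight-count a b c (catalanWords a)))

Σ∈-coeff-zero : ∀ {A : Set} (xs : List A) Φ a b c → (∀ x → Φ x a b c ≡ + 0) → Σ∈ xs Φ a b c ≡ + 0
Σ∈-coeff-zero []       Φ a b c Φ≡0 = refl
Σ∈-coeff-zero (x ∷ xs) Φ a b c Φ≡0 = cong₂ ℤ._+_ (Φ≡0 x) (Σ∈-coeff-zero xs Φ a b c Φ≡0)

layer-off-diagonal : ∀ n s t a b c → a ≢ n → layer n s t a b c ≡ + 0
layer-off-diagonal n s t a b c a≢n =
  ≡.trans (unwrap (Σ∈-bySnoc-cong n (λ w |w|≡n → mono-cong |w|≡n refl refl)) a b c)
    (Σ∈-coeff-zero (catalanWordsBySnoc n) _ a b c λ w → mono-coeff-≢ b c a≢n)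

evenLayer-off-diagonal : ∀ n s t a b c → a ≢ n → evenLayer n s t a b c ≡ + 0
evenLayer-off-diagonal n s t a b c a≢n with isEven n
... | true  = layer-off-diagonal n s t a b c a≢n
... | false = refl

oddLayer-off-diagonal : ∀ n s t a b c → a ≢ n → oddLayer n s t a b c ≡ + 0
oddLayer-off-diagonal n s t a b c a≢n with isEven n
... | true  = refl
... | false = layer-off-diagonal n s t a b c a≢n

xSum-diagonal : ∀ T a b c → (∀ n → a ≢ n → T n a b c ≡ + 0) → xSum T a b c ≡ T a a b c
xSum-diagonal T a b c T≡0 = sumTo-last a (λ n → T n a b c) (λ n n<a → T≡0 n (ℕ.>⇒≢ n<a))

%2≡isEven : ∀ a → a % 2 ≡ (if isEven a then 0 else 1)
%2≡isEven zero          = refl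
%2≡isEven (suc zero)    = refl
%2≡isEven (suc (suc a)) = ≡.trans (≡.trans (cong (_% 2) (ℕ.+-comm 2 a)) ([m+n]%n≡m%n a 2))
  (≡.trans (%2≡isEven a) (cong (λ β → if β then 0 else 1) (≡.sym (Bool.not-involutive (isEven a)))))

EV1≋EVᵘ : EV1 ≋ EVᵘ 0 0
EV1≋EVᵘ = wrap λ a b c → ≡.sym (≡.trans
  (xSum-diagonal (λ n → evenLayer n 0 0) a b c (λ n → evenLayer-off-diagonal n 0 0 a b c)) (diagonal a b c))
  where
  diagonal : ∀ a b c → evenLayer a 0 0 a b c ≡ EV1 a b c
  diagonal a b c rewrite %2≡isEven a with isEven a
  ... | true  = layer-coeff a b c
  ... | false = refl

OD1≋ODᵘ : OD1 ≋ ODᵘ 0 0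
OD1≋ODᵘ = wrap λ a b c → ≡.sym (≡.trans
  (xSum-diagonal (λ n → oddLayer n 0 0) a b c (λ n → oddLayer-off-diagonal n 0 0 a b c)) (diagonal a b c))
  where
  diagonal : ∀ a b c → oddLayer a 0 0 a b c ≡ OD1 a b c
  diagonal a b c rewrite %2≡isEven a with isEven a
  ... | true  = refl
  ... | false = layer-coeff a b c

divide-by-1⊖ : ∀ {U R} r → r 0 0 0 ≡ + 0 → U ⊛ (onePS ⊖ r) ≋ R → U ≋ R ⊛ geometric r
divide-by-1⊖ {U} {R} r r₀≡0 U⊛[1⊖r]≋R = begin
  U                                    ≈⟨ PSR.*-identityʳ U ⟨
  U ⊛ onePS                            ≈⟨ ⊛-congˡ U (1⊖-⊛-geometric r r₀≡0) ⟨
  U ⊛ ((onePS ⊖ r) ⊛ geometric r)      ≈⟨ PSR.*-assoc U (onePS ⊖ r) (geometric r) ⟨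
  U ⊛ (onePS ⊖ r) ⊛ geometric r        ≈⟨ ⊛-congʳ (geometric r) U⊛[1⊖r]≋R ⟩
  R ⊛ geometric r                      ∎

module Unroll (U : ℕ → PS) (P Q : PS) (α β γ δ : ℕ → PS)
  (U-step : ∀ k → U k ≋ α k ⊕ β k ⊛ P ⊕ γ k ⊛ Q ⊕ δ k ⊛ U (suc k))
  (ord≥-δ : ∀ k → ord≥ 1 (δ k)) where

  Δ : ℕ → PS
  Δ zero    = onePS
  Δ (suc k) = Δ k ⊛ δ k

  term : ℕ → PS
  term k = Δ k ⊛ (α k ⊕ β k ⊛ P ⊕ γ k ⊛ Q)

  U₀≋partial : ∀ N → U 0 ≋ Σ≤ N term ⊕ Δ (suc N) ⊛ U (suc N)
  U₀≋partial zero = PSR.trans (U-step 0)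
    (solve 7 (λ a b g d p q u → a :+ b :* p :+ g :* q :+ d :* u
                                := con (+ 1) :* (a :+ b :* p :+ g :* q) :+ (con (+ 1) :* d) :* u)
       PSR.refl (α 0) (β 0) (γ 0) (δ 0) P Q (U 1))
  U₀≋partial (suc N) = begin
    U 0                                        ≈⟨ U₀≋partial N ⟩
    Σ≤ N term ⊕ Δ (suc N) ⊛ U (suc N)          ≈⟨ ⊕-congˡ (Σ≤ N term) (⊛-congˡ (Δ (suc N)) (U-step (suc N))) ⟩
    Σ≤ N term ⊕ Δ (suc N) ⊛ (α (suc N) ⊕ β (suc N) ⊛ P ⊕ γ (suc N) ⊛ Q ⊕ δ (suc N) ⊛ U (2 + N))
      ≈⟨ solve 9 (λ s d a b g d′ p q u → s :+ d :* (a :+ b :* p :+ g :* q :+ d′ :* u)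
                                       := (s :+ d :* (a :+ b :* p :+ g :* q)) :+ (d :* d′) :* u)
           PSR.refl (Σ≤ N term) (Δ (suc N)) (α (suc N)) (β (suc N)) (γ (suc N)) (δ (suc N)) P Q (U (2 + N)) ⟩
    Σ≤ (suc N) term ⊕ Δ (2 + N) ⊛ U (2 + N)  ∎

  ord≥-Δ⊛ : ∀ k F → ord≥ k (Δ k ⊛ F)
  ord≥-Δ⊛ k F = ≡.subst (λ n → ord≥ n (Δ k ⊛ F)) (ℕ.+-identityʳ k) (ord≥-⊛ (ord≥-Δ k) (ord≥-0 F))
    where
    ord≥-Δ : ∀ k → ord≥ k (Δ k)
    ord≥-Δ zero    = ord≥-0 onePS
    ord≥-Δ (suc k) = ≡.subst (λ n → ord≥ n (Δ (suc k))) (ℕ.+-comm k 1) (ord≥-⊛ (ord≥-Δ k) (ord≥-δ k))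

  Tα Tβ Tγ : ℕ → PS
  Tα k = Δ k ⊛ α k
  Tβ k = Δ k ⊛ β k
  Tγ k = Δ k ⊛ γ k

  U₀≈[≤]Σ≤ : ∀ N → U 0 ≈[≤ N ] Σ≤ N term
  U₀≈[≤]Σ≤ N = ≈[≤]-trans (≋⇒≈[≤] N (U₀≋partial N))
    (≈[≤]-trans (≈[≤]-⊕ (≈[≤]-refl {Σ≤ N term} N) (ord≥⇒≈[≤]zeroPS (ord≥-Δ⊛ (suc N) (U (suc N)))))
                (≋⇒≈[≤] N (PSR.+-identityʳ _)))

  U₀≋xSum : U 0 ≋ xSum Tα ⊕ P ⊛ xSum Tβ ⊕ Q ⊛ xSum Tγ
  U₀≋xSum = begin
    U 0
      ≈⟨ xSum-unique term (λ k → ord≥-Δ⊛ k (α k ⊕ β k ⊛ P ⊕ γ k ⊛ Q)) U₀≈[≤]Σ≤ ⟩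
    xSum term
      ≈⟨ xSum-cong (λ k → solve 6 (λ d a b g p q → d :* (a :+ b :* p :+ g :* q) := d :* a :+ p :* (d :* b) :+ q :* (d :* g))
           PSR.refl (Δ k) (α k) (β k) (γ k) P Q) ⟩
    xSum (λ k → Tα k ⊕ P ⊛ Tβ k ⊕ Q ⊛ Tγ k)
      ≈⟨ PSR.trans (xSum-⊕ (λ k → Tα k ⊕ P ⊛ Tβ k) (λ k → Q ⊛ Tγ k))
                   (⊕-congʳ (xSum (λ k → Q ⊛ Tγ k)) (xSum-⊕ Tα (λ k → P ⊛ Tβ k))) ⟩
    xSum Tα ⊕ xSum (λ k → P ⊛ Tβ k) ⊕ xSum (λ k → Q ⊛ Tγ k)
      ≈⟨ PSR.+-cong (⊕-congˡ (xSum Tα) (xSum-⊛ˡ P Tβ (λ k → ord≥-Δ⊛ k (β k))))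
                    (xSum-⊛ˡ Q Tγ (λ k → ord≥-Δ⊛ k (γ k))) ⟨
    xSum Tα ⊕ P ⊛ xSum Tβ ⊕ Q ⊛ xSum Tγ  ∎

yqᵏ zqᵏ qᵏ⁺¹ : ℕ → PS
yqᵏ  k = mono 0 (suc k) k
zqᵏ  k = mono 0 k (suc k)
qᵏ⁺¹ k = mono 0 (suc k) (suc k)

Pʸ Pᶻ Pᵠ : ℕ → PS
Pʸ k = inv (poch Y YZ k)
Pᶻ k = inv (poch Z YZ k)
Pᵠ k = inv (poch YZ YZ k)

Pʸ-suc : ∀ k → Pʸ k ⊛ geometric (yqᵏ k) ≋ Pʸ (suc k)
Pʸ-suc k = inv-poch-⊛-geometric Y k refl (Y⊛pow-YZ k)

Pᶻ-suc : ∀ k → Pᶻ k ⊛ geometric (zqᵏ k) ≋ Pᶻ (suc k)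
Pᶻ-suc k = inv-poch-⊛-geometric Z k refl (Z⊛pow-YZ k)

Pᵠ-suc : ∀ k → Pᵠ k ⊛ geometric (qᵏ⁺¹ k) ≋ Pᵠ (suc k)
Pᵠ-suc k = inv-poch-⊛-geometric YZ k refl (YZ⊛pow-YZ k)

fTerm gTerm φTerm ψTerm : ℕ → PS
fTerm k = mono (2 * k + 2) (2 * k + 1 + k * (2 * k + 1)) (4 * k + 3 + k * (2 * k + 1))
  ⊛ inv (poch Z YZ (suc k)) ⊛ inv (poch YZ YZ k)
gTerm k = mono (2 * k + 1) (4 * k + 1 + k * (2 * k ∸ 1)) (2 * k + k * (2 * k ∸ 1))
  ⊛ inv (poch Y YZ k) ⊛ inv (poch YZ YZ k)
φTerm k = mono (2 * k + 2) (2 * k + 1 + k * (2 * k + 1)) (4 * k + 3 + k * (2 * k + 1))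
  ⊛ inv (poch Z YZ (suc k)) ⊛ inv (poch YZ YZ (suc k))
ψTerm k = mono (2 * k + 1) (2 * k + k * (2 * k ∸ 1)) (4 * k + 1 + k * (2 * k ∸ 1))
  ⊛ inv (poch Z YZ (suc k)) ⊛ inv (poch YZ YZ k)

swapYZ-Pᶻ : ∀ m → swapYZ (Pᶻ m) ≋ Pʸ m
swapYZ-Pᶻ m = PSR.trans (swapYZ-inv (poch Z YZ m))
  (inv-cong (PSR.trans (swapYZ-poch Z YZ m) (poch-cong m (swapYZ-mono 0 0 1) swapYZ-YZ)))

swapYZ-Pᵠ : ∀ n → swapYZ (Pᵠ n) ≋ Pᵠ n
swapYZ-Pᵠ n = PSR.trans (swapYZ-inv (poch YZ YZ n))
  (inv-cong (PSR.trans (swapYZ-poch YZ YZ n) (poch-cong n swapYZ-YZ swapYZ-YZ)))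

swapYZ-term : ∀ a b c m n → swapYZ (mono a b c ⊛ Pᶻ m ⊛ Pᵠ n) ≋ mono a c b ⊛ Pʸ m ⊛ Pᵠ n
swapYZ-term a b c m n = begin
  swapYZ (mono a b c ⊛ Pᶻ m ⊛ Pᵠ n)
    ≈⟨ PSR.trans (swapYZ-⊛ (mono a b c ⊛ Pᶻ m) (Pᵠ n)) (⊛-congʳ (swapYZ (Pᵠ n)) (swapYZ-⊛ (mono a b c) (Pᶻ m))) ⟩
  swapYZ (mono a b c) ⊛ swapYZ (Pᶻ m) ⊛ swapYZ (Pᵠ n)
    ≈⟨ PSR.*-cong (PSR.*-cong (swapYZ-mono a b c) (swapYZ-Pᶻ m)) (swapYZ-Pᵠ n) ⟩
  mono a c b ⊛ Pʸ m ⊛ Pᵠ n  ∎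

-- Defs writes the exponent k(2k-1) as k * (2 * k ∸ 1); the truncation at k = 0 is harmless.
k[2k∸1]+k : ∀ k → k * (2 * k ∸ 1) + k ≡ 2 * (k * k)
k[2k∸1]+k zero    = refl
k[2k∸1]+k (suc k) = ≡.trans (cong (λ e → suc k * e + suc k) (2[1+k]∸1 k)) (arith k)
  where
  2[1+k]∸1 : ∀ k → 2 * suc k ∸ 1 ≡ suc (2 * k)
  2[1+k]∸1 k = cong (ℕ._∸ 1) (ℕ.*-suc 2 k)
  arith : ∀ k → suc k * suc (2 * k) + suc k ≡ 2 * (suc k * suc k)
  arith = solve-∀

αᴼ βᴼ γᴼ δᴼ : ℕ → PS
αᴼ k = X ⊛ yqᵏ k
βᴼ k = X ⊛ yqᵏ k ⊛ geometric (yqᵏ k)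
γᴼ k = ⊝ (X ⊛ X ⊛ yqᵏ k ⊛ yqᵏ k ⊛ qᵏ⁺¹ k ⊛ geometric (yqᵏ k) ⊛ geometric (qᵏ⁺¹ k))
δᴼ k = X ⊛ X ⊛ yqᵏ k ⊛ yqᵏ k ⊛ qᵏ⁺¹ k ⊛ qᵏ⁺¹ k ⊛ geometric (yqᵏ k) ⊛ geometric (qᵏ⁺¹ k)

OD-diagonal-step : ∀ k → ODᵘ k k ≋ αᴼ k ⊕ βᴼ k ⊛ EVᵘ 0 0 ⊕ γᴼ k ⊛ ODᵘ 0 0 ⊕ δᴼ k ⊛ ODᵘ (suc k) (suc k)
OD-diagonal-step k = begin
  ODᵘ k k
    ≈⟨ divide-by-1⊖ a refl (OD-equation k k) ⟩
  (X ⊛ (a ⊛ (onePS ⊖ a)) ⊕ X ⊛ (a ⊛ (E ⊖ a ⊛ V))) ⊛ ia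
    ≈⟨ solve 5 (λ x a e v i → (x :* (a :* (con (+ 1) :- a)) :+ x :* (a :* (e :- a :* v))) :* i
                := x :* a :* ((con (+ 1) :- a) :* i) :+ x :* a :* i :* e :- x :* a :* a :* i :* v) PSR.refl X a E V ia ⟩
  X ⊛ a ⊛ ((onePS ⊖ a) ⊛ ia) ⊕ X ⊛ a ⊛ ia ⊛ E ⊖ X ⊛ a ⊛ a ⊛ ia ⊛ V
    ≈⟨ PSR.+-cong (⊕-congʳ (X ⊛ a ⊛ ia ⊛ E) (⊛-congˡ (X ⊛ a) (1⊖-⊛-geometric a refl)))
                  (PSR.-‿cong (⊛-congˡ (X ⊛ a ⊛ a ⊛ ia) (divide-by-1⊖ {V} b refl (EV-equation (suc k) k)))) ⟩
  X ⊛ a ⊛ onePS ⊕ X ⊛ a ⊛ ia ⊛ E ⊖ X ⊛ a ⊛ a ⊛ ia ⊛ (X ⊛ (b ⊛ (O ⊖ b ⊛ U′)) ⊛ ib)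
    ≈⟨ solve 8 (λ x a b e o u′ i j →
                  x :* a :* con (+ 1) :+ x :* a :* i :* e :- x :* a :* a :* i :* (x :* (b :* (o :- b :* u′)) :* j)
                  := x :* a :+ x :* a :* i :* e :+ (:- (x :* x :* a :* a :* b :* i :* j)) :* o
                     :+ (x :* x :* a :* a :* b :* b :* i :* j) :* u′)
         PSR.refl X a b E O U′ ia ib ⟩
  αᴼ k ⊕ βᴼ k ⊛ E ⊕ γᴼ k ⊛ O ⊕ δᴼ k ⊛ U′  ∎
  where
  a = yqᵏ k
  b = qᵏ⁺¹ k
  ia = geometric a
  ib = geometric b
  E = EVᵘ 0 0
  O = ODᵘ 0 0
  V = EVᵘ (suc k) k
  U′ = ODᵘ (suc k) (suc k)

ord≥1-⊛ : ∀ {F} G → ord≥ 1 F → ord≥ 1 (F ⊛ G)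
ord≥1-⊛ G F≥1 = ord≥-⊛ F≥1 (ord≥-0 G)

ord≥1-X⊛X : ord≥ 1 (X ⊛ X)
ord≥1-X⊛X = ord≥1-⊛ X ord≥-X

ord≥-δᴼ : ∀ k → ord≥ 1 (δᴼ k)
ord≥-δᴼ k = ord≥1-⊛ (geometric (qᵏ⁺¹ k)) (ord≥1-⊛ (geometric (yqᵏ k)) (ord≥1-⊛ (qᵏ⁺¹ k) (ord≥1-⊛ (qᵏ⁺¹ k)
  (ord≥1-⊛ (yqᵏ k) (ord≥1-⊛ (yqᵏ k) ord≥1-X⊛X)))))

module OD-row = Unroll (λ k → ODᵘ k k) (EVᵘ 0 0) (ODᵘ 0 0) αᴼ βᴼ γᴼ δᴼ OD-diagonal-step ord≥-δᴼ

monoΔᴼ : ℕ → PS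
monoΔᴼ k = mono (2 * k) (2 * k + 2 * (k * k)) (2 * (k * k))

OD-row-Δ : ∀ k → OD-row.Δ k ≋ monoΔᴼ k ⊛ Pʸ k ⊛ Pᵠ k
OD-row-Δ zero = PSR.sym (PSR.trans (PSR.*-cong (⊛-congˡ onePS inv-onePS) inv-onePS)
                                   (PSR.trans (PSR.*-identityʳ _) (PSR.*-identityʳ onePS)))
OD-row-Δ (suc k) = begin
  OD-row.Δ k ⊛ δᴼ k
    ≈⟨ ⊛-congʳ (δᴼ k) (OD-row-Δ k) ⟩
  monoΔᴼ k ⊛ Pʸ k ⊛ Pᵠ k ⊛ δᴼ k
    ≈⟨ solve 8 (λ m p q x a b i j → (m :* p :* q) :* (x :* x :* a :* a :* b :* b :* i :* j)
                  := (m :* x :* x :* a :* a :* b :* b) :* (p :* i) :* (q :* j))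
         PSR.refl (monoΔᴼ k) (Pʸ k) (Pᵠ k) X (yqᵏ k) (qᵏ⁺¹ k) (geometric (yqᵏ k)) (geometric (qᵏ⁺¹ k)) ⟩
  monoΔᴼ k ⊛ X ⊛ X ⊛ yqᵏ k ⊛ yqᵏ k ⊛ qᵏ⁺¹ k ⊛ qᵏ⁺¹ k ⊛ (Pʸ k ⊛ geometric (yqᵏ k)) ⊛ (Pᵠ k ⊛ geometric (qᵏ⁺¹ k))
    ≈⟨ PSR.*-cong (PSR.*-cong monomial (Pʸ-suc k)) (Pᵠ-suc k) ⟩
  monoΔᴼ (suc k) ⊛ Pʸ (suc k) ⊛ Pᵠ (suc k)  ∎
  where
  monomial : monoΔᴼ k ⊛ X ⊛ X ⊛ yqᵏ k ⊛ yqᵏ k ⊛ qᵏ⁺¹ k ⊛ qᵏ⁺¹ k ≋ monoΔᴼ (suc k)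
  monomial = PSR.trans
    (mono-⊛-mono′ 0 (suc k) (suc k) (mono-⊛-mono′ 0 (suc k) (suc k) (mono-⊛-mono′ 0 (suc k) k
      (mono-⊛-mono′ 0 (suc k) k (mono-⊛-mono′ 1 0 0 (mono-⊛-mono′ 1 0 0 (PSR.refl {monoΔᴼ k})))))))
    (mono-cong (x-exp k) (y-exp k) (z-exp k))
    where
    x-exp : ∀ k → 2 * k + 1 + 1 + 0 + 0 + 0 + 0 ≡ 2 * suc k
    x-exp = solve-∀
    y-exp : ∀ k → 2 * k + 2 * (k * k) + 0 + 0 + suc k + suc k + suc k + suc k
                  ≡ 2 * suc k + 2 * (suc k * suc k)
    y-exp = solve-∀
    z-exp : ∀ k → 2 * (k * k) + 0 + 0 + k + k + suc k + suc k ≡ 2 * (suc k * suc k)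
    z-exp = solve-∀

monoΔᴼ⊛X⊛yqᵏ : ∀ k → monoΔᴼ k ⊛ X ⊛ yqᵏ k ≋
  mono (2 * k + 1) (4 * k + 1 + k * (2 * k ∸ 1)) (2 * k + k * (2 * k ∸ 1))
monoΔᴼ⊛X⊛yqᵏ k = PSR.trans (mono-⊛-mono′ 0 (suc k) k (mono-⊛-mono′ 1 0 0 (PSR.refl {monoΔᴼ k})))
  (mono-cong (x-exp k)
             (≡.trans (cong (λ e → 2 * k + e + 0 + suc k) (≡.sym (k[2k∸1]+k k))) (y-exp k (k * (2 * k ∸ 1))))
             (≡.trans (cong (λ e → e + 0 + k) (≡.sym (k[2k∸1]+k k))) (z-exp k (k * (2 * k ∸ 1)))))
  where
  x-exp : ∀ k → 2 * k + 1 + 0 ≡ 2 * k + 1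
  x-exp = solve-∀
  y-exp : ∀ k e → 2 * k + (e + k) + 0 + suc k ≡ 4 * k + 1 + e
  y-exp = solve-∀
  z-exp : ∀ k e → e + k + 0 + k ≡ 2 * k + e
  z-exp = solve-∀

monoΔᴼ⊛X⊛X⊛yqᵏ⊛yqᵏ⊛qᵏ⁺¹ : ∀ k → monoΔᴼ k ⊛ X ⊛ X ⊛ yqᵏ k ⊛ yqᵏ k ⊛ qᵏ⁺¹ k ≋
  mono (2 * k + 2) (4 * k + 3 + k * (2 * k + 1)) (2 * k + 1 + k * (2 * k + 1))
monoΔᴼ⊛X⊛X⊛yqᵏ⊛yqᵏ⊛qᵏ⁺¹ k = PSR.trans
  (mono-⊛-mono′ 0 (suc k) (suc k) (mono-⊛-mono′ 0 (suc k) k (mono-⊛-mono′ 0 (suc k) k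
    (mono-⊛-mono′ 1 0 0 (mono-⊛-mono′ 1 0 0 (PSR.refl {monoΔᴼ k}))))))
  (mono-cong (x-exp k) (y-exp k) (z-exp k))
  where
  x-exp : ∀ k → 2 * k + 1 + 1 + 0 + 0 + 0 ≡ 2 * k + 2
  x-exp = solve-∀
  y-exp : ∀ k → 2 * k + 2 * (k * k) + 0 + 0 + suc k + suc k + suc k ≡ 4 * k + 3 + k * (2 * k + 1)
  y-exp = solve-∀
  z-exp : ∀ k → 2 * (k * k) + 0 + 0 + k + k + suc k ≡ 2 * k + 1 + k * (2 * k + 1)
  z-exp = solve-∀

OD-row-α : ∀ k → OD-row.Tα k ≋ gTerm k
OD-row-α k = begin
  OD-row.Δ k ⊛ (X ⊛ yqᵏ k)                   ≈⟨ ⊛-congʳ (X ⊛ yqᵏ k) (OD-row-Δ k) ⟩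
  monoΔᴼ k ⊛ Pʸ k ⊛ Pᵠ k ⊛ (X ⊛ yqᵏ k)
    ≈⟨ solve 5 (λ m p q x a → (m :* p :* q) :* (x :* a) := m :* x :* a :* p :* q)
         PSR.refl (monoΔᴼ k) (Pʸ k) (Pᵠ k) X (yqᵏ k) ⟩
  monoΔᴼ k ⊛ X ⊛ yqᵏ k ⊛ Pʸ k ⊛ Pᵠ k         ≈⟨ ⊛-congʳ (Pᵠ k) (⊛-congʳ (Pʸ k) (monoΔᴼ⊛X⊛yqᵏ k)) ⟩
  gTerm k                                    ∎

OD-row-β : ∀ k → OD-row.Tβ k ≋ swapYZ (ψTerm k)
OD-row-β k = begin
  OD-row.Δ k ⊛ (X ⊛ yqᵏ k ⊛ geometric (yqᵏ k))
    ≈⟨ ⊛-congʳ (X ⊛ yqᵏ k ⊛ geometric (yqᵏ k)) (OD-row-Δ k) ⟩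
  monoΔᴼ k ⊛ Pʸ k ⊛ Pᵠ k ⊛ (X ⊛ yqᵏ k ⊛ geometric (yqᵏ k))
    ≈⟨ solve 6 (λ m p q x a i → (m :* p :* q) :* (x :* a :* i) := m :* x :* a :* (p :* i) :* q)
         PSR.refl (monoΔᴼ k) (Pʸ k) (Pᵠ k) X (yqᵏ k) (geometric (yqᵏ k)) ⟩
  monoΔᴼ k ⊛ X ⊛ yqᵏ k ⊛ (Pʸ k ⊛ geometric (yqᵏ k)) ⊛ Pᵠ k
    ≈⟨ ⊛-congʳ (Pᵠ k) (PSR.*-cong (monoΔᴼ⊛X⊛yqᵏ k) (Pʸ-suc k)) ⟩
  mono (2 * k + 1) (4 * k + 1 + k * (2 * k ∸ 1)) (2 * k + k * (2 * k ∸ 1)) ⊛ Pʸ (suc k) ⊛ Pᵠ k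
    ≈⟨ swapYZ-term _ _ _ (suc k) k ⟨
  swapYZ (ψTerm k)  ∎

OD-row-γ : ∀ k → OD-row.Tγ k ≋ ⊝ swapYZ (φTerm k)
OD-row-γ k = begin
  OD-row.Δ k ⊛ γᴼ k
    ≈⟨ ⊛-congʳ (γᴼ k) (OD-row-Δ k) ⟩
  monoΔᴼ k ⊛ Pʸ k ⊛ Pᵠ k ⊛ γᴼ k
    ≈⟨ solve 8 (λ m p q x a b i j → (m :* p :* q) :* :- (x :* x :* a :* a :* b :* i :* j)
                  := :- (m :* x :* x :* a :* a :* b :* (p :* i) :* (q :* j)))
         PSR.refl (monoΔᴼ k) (Pʸ k) (Pᵠ k) X (yqᵏ k) (qᵏ⁺¹ k) (geometric (yqᵏ k)) (geometric (qᵏ⁺¹ k)) ⟩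
  ⊝ (monoΔᴼ k ⊛ X ⊛ X ⊛ yqᵏ k ⊛ yqᵏ k ⊛ qᵏ⁺¹ k ⊛ (Pʸ k ⊛ geometric (yqᵏ k)) ⊛ (Pᵠ k ⊛ geometric (qᵏ⁺¹ k)))
    ≈⟨ PSR.-‿cong (PSR.*-cong (PSR.*-cong (monoΔᴼ⊛X⊛X⊛yqᵏ⊛yqᵏ⊛qᵏ⁺¹ k) (Pʸ-suc k)) (Pᵠ-suc k)) ⟩
  ⊝ (mono (2 * k + 2) (4 * k + 3 + k * (2 * k + 1)) (2 * k + 1 + k * (2 * k + 1))
       ⊛ Pʸ (suc k) ⊛ Pᵠ (suc k))
    ≈⟨ PSR.-‿cong (swapYZ-term _ _ _ (suc k) (suc k)) ⟨
  ⊝ swapYZ (φTerm k)  ∎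

OD-row-equation : ODᵘ 0 0 ≋ gS ⊕ EVᵘ 0 0 ⊛ (⊝ swapYZ ψS) ⊕ ODᵘ 0 0 ⊛ (⊝ swapYZ φS)
OD-row-equation = PSR.trans OD-row.U₀≋xSum (PSR.+-cong (PSR.+-cong
  (xSum-cong OD-row-α)
  (⊛-congˡ (EVᵘ 0 0) (PSR.trans (xSum-cong OD-row-β) (PSR.sym (⊝-involutive (swapYZ (xSum ψTerm)))))))
  (⊛-congˡ (ODᵘ 0 0) (PSR.trans (xSum-cong OD-row-γ) (xSum-⊝ (λ k → swapYZ (φTerm k))))))

zqᵏ-constant : ∀ k → zqᵏ k 0 0 0 ≡ + 0
zqᵏ-constant zero    = refl
zqᵏ-constant (suc k) = refl

αᴱ βᴱ γᴱ δᴱ : ℕ → PS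
αᴱ k = ⊝ (X ⊛ X ⊛ zqᵏ k ⊛ zqᵏ k ⊛ qᵏ⁺¹ k ⊛ geometric (zqᵏ k))
βᴱ k = X ⊛ zqᵏ k ⊛ geometric (zqᵏ k)
γᴱ k = ⊝ (X ⊛ X ⊛ zqᵏ k ⊛ zqᵏ k ⊛ qᵏ⁺¹ k ⊛ geometric (qᵏ⁺¹ k) ⊛ geometric (zqᵏ k))
δᴱ k = X ⊛ X ⊛ zqᵏ k ⊛ zqᵏ k ⊛ qᵏ⁺¹ k ⊛ qᵏ⁺¹ k ⊛ geometric (qᵏ⁺¹ k) ⊛ geometric (zqᵏ k)

EV-diagonal-step : ∀ k → EVᵘ k k ≋ αᴱ k ⊕ βᴱ k ⊛ ODᵘ 0 0 ⊕ γᴱ k ⊛ EVᵘ 0 0 ⊕ δᴱ k ⊛ EVᵘ (suc k) (suc k)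
EV-diagonal-step k = begin
  EVᵘ k k
    ≈⟨ divide-by-1⊖ c (zqᵏ-constant k) (EV-equation k k) ⟩
  X ⊛ (c ⊛ (O ⊖ c ⊛ W)) ⊛ ic
    ≈⟨ ⊛-congʳ ic (⊛-congˡ X (⊛-congˡ c (⊕-congˡ O (PSR.-‿cong (⊛-congˡ c W-closed))))) ⟩
  X ⊛ (c ⊛ (O ⊖ c ⊛ (X ⊛ b ⊕ X ⊛ b ⊛ ib ⊛ E ⊖ X ⊛ b ⊛ b ⊛ ib ⊛ E′))) ⊛ ic
    ≈⟨ solve 8 (λ x c b e o e′ i j → x :* (c :* (o :- c :* (x :* b :+ x :* b :* j :* e :- x :* b :* b :* j :* e′))) :* i
                := :- (x :* x :* c :* c :* b :* i) :+ (x :* c :* i) :* o :+ (:- (x :* x :* c :* c :* b :* j :* i)) :* e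
                   :+ (x :* x :* c :* c :* b :* b :* j :* i) :* e′)
         PSR.refl X c b E O E′ ic ib ⟩
  αᴱ k ⊕ βᴱ k ⊛ O ⊕ γᴱ k ⊛ E ⊕ δᴱ k ⊛ E′  ∎
  where
  b = qᵏ⁺¹ k
  c = zqᵏ k
  ib = geometric b
  ic = geometric c
  E = EVᵘ 0 0
  O = ODᵘ 0 0
  W = ODᵘ k (suc k)
  E′ = EVᵘ (suc k) (suc k)
  W-closed : W ≋ X ⊛ b ⊕ X ⊛ b ⊛ ib ⊛ E ⊖ X ⊛ b ⊛ b ⊛ ib ⊛ E′
  W-closed = begin
    W
      ≈⟨ divide-by-1⊖ b refl (OD-equation k (suc k)) ⟩
    (X ⊛ (b ⊛ (onePS ⊖ b)) ⊕ X ⊛ (b ⊛ (E ⊖ b ⊛ E′))) ⊛ ib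
      ≈⟨ solve 5 (λ x b e e′ j → (x :* (b :* (con (+ 1) :- b)) :+ x :* (b :* (e :- b :* e′))) :* j
                  := x :* b :* ((con (+ 1) :- b) :* j) :+ x :* b :* j :* e :- x :* b :* b :* j :* e′) PSR.refl X b E E′ ib ⟩
    X ⊛ b ⊛ ((onePS ⊖ b) ⊛ ib) ⊕ X ⊛ b ⊛ ib ⊛ E ⊖ X ⊛ b ⊛ b ⊛ ib ⊛ E′
      ≈⟨ ⊕-congʳ (⊝ (X ⊛ b ⊛ b ⊛ ib ⊛ E′)) (⊕-congʳ (X ⊛ b ⊛ ib ⊛ E)
           (PSR.trans (⊛-congˡ (X ⊛ b) (1⊖-⊛-geometric b refl)) (PSR.*-identityʳ (X ⊛ b)))) ⟩
    X ⊛ b ⊕ X ⊛ b ⊛ ib ⊛ E ⊖ X ⊛ b ⊛ b ⊛ ib ⊛ E′  ∎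

ord≥-δᴱ : ∀ k → ord≥ 1 (δᴱ k)
ord≥-δᴱ k = ord≥1-⊛ (geometric (zqᵏ k)) (ord≥1-⊛ (geometric (qᵏ⁺¹ k)) (ord≥1-⊛ (qᵏ⁺¹ k) (ord≥1-⊛ (qᵏ⁺¹ k)
  (ord≥1-⊛ (zqᵏ k) (ord≥1-⊛ (zqᵏ k) ord≥1-X⊛X)))))

module EV-row = Unroll (λ k → EVᵘ k k) (ODᵘ 0 0) (EVᵘ 0 0) αᴱ βᴱ γᴱ δᴱ EV-diagonal-step ord≥-δᴱ

monoΔᴱ : ℕ → PS
monoΔᴱ k = mono (2 * k) (2 * (k * k)) (2 * k + 2 * (k * k))

EV-row-Δ : ∀ k → EV-row.Δ k ≋ monoΔᴱ k ⊛ Pᶻ k ⊛ Pᵠ k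
EV-row-Δ zero = PSR.sym (PSR.trans (PSR.*-cong (⊛-congˡ onePS inv-onePS) inv-onePS)
                                   (PSR.trans (PSR.*-identityʳ _) (PSR.*-identityʳ onePS)))
EV-row-Δ (suc k) = begin
  EV-row.Δ k ⊛ δᴱ k
    ≈⟨ ⊛-congʳ (δᴱ k) (EV-row-Δ k) ⟩
  monoΔᴱ k ⊛ Pᶻ k ⊛ Pᵠ k ⊛ δᴱ k
    ≈⟨ solve 8 (λ m p q x a b j i → (m :* p :* q) :* (x :* x :* a :* a :* b :* b :* j :* i)
                  := (m :* x :* x :* a :* a :* b :* b) :* (p :* i) :* (q :* j))
         PSR.refl (monoΔᴱ k) (Pᶻ k) (Pᵠ k) X (zqᵏ k) (qᵏ⁺¹ k) (geometric (qᵏ⁺¹ k)) (geometric (zqᵏ k)) ⟩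
  monoΔᴱ k ⊛ X ⊛ X ⊛ zqᵏ k ⊛ zqᵏ k ⊛ qᵏ⁺¹ k ⊛ qᵏ⁺¹ k ⊛ (Pᶻ k ⊛ geometric (zqᵏ k)) ⊛ (Pᵠ k ⊛ geometric (qᵏ⁺¹ k))
    ≈⟨ PSR.*-cong (PSR.*-cong monomial (Pᶻ-suc k)) (Pᵠ-suc k) ⟩
  monoΔᴱ (suc k) ⊛ Pᶻ (suc k) ⊛ Pᵠ (suc k)  ∎
  where
  monomial : monoΔᴱ k ⊛ X ⊛ X ⊛ zqᵏ k ⊛ zqᵏ k ⊛ qᵏ⁺¹ k ⊛ qᵏ⁺¹ k ≋ monoΔᴱ (suc k)
  monomial = PSR.trans
    (mono-⊛-mono′ 0 (suc k) (suc k) (mono-⊛-mono′ 0 (suc k) (suc k) (mono-⊛-mono′ 0 k (suc k)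
      (mono-⊛-mono′ 0 k (suc k) (mono-⊛-mono′ 1 0 0 (mono-⊛-mono′ 1 0 0 (PSR.refl {monoΔᴱ k})))))))
    (mono-cong (x-exp k) (y-exp k) (z-exp k))
    where
    x-exp : ∀ k → 2 * k + 1 + 1 + 0 + 0 + 0 + 0 ≡ 2 * suc k
    x-exp = solve-∀
    y-exp : ∀ k → 2 * (k * k) + 0 + 0 + k + k + suc k + suc k ≡ 2 * (suc k * suc k)
    y-exp = solve-∀
    z-exp : ∀ k → 2 * k + 2 * (k * k) + 0 + 0 + suc k + suc k + suc k + suc k
                  ≡ 2 * suc k + 2 * (suc k * suc k)
    z-exp = solve-∀

monoΔᴱ⊛X⊛zqᵏ : ∀ k → monoΔᴱ k ⊛ X ⊛ zqᵏ k ≋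
  mono (2 * k + 1) (2 * k + k * (2 * k ∸ 1)) (4 * k + 1 + k * (2 * k ∸ 1))
monoΔᴱ⊛X⊛zqᵏ k = PSR.trans (mono-⊛-mono′ 0 k (suc k) (mono-⊛-mono′ 1 0 0 (PSR.refl {monoΔᴱ k})))
  (mono-cong (x-exp k)
             (≡.trans (cong (λ e → e + 0 + k) (≡.sym (k[2k∸1]+k k))) (y-exp k (k * (2 * k ∸ 1))))
             (≡.trans (cong (λ e → 2 * k + e + 0 + suc k) (≡.sym (k[2k∸1]+k k))) (z-exp k (k * (2 * k ∸ 1)))))
  where
  x-exp : ∀ k → 2 * k + 1 + 0 ≡ 2 * k + 1
  x-exp = solve-∀
  y-exp : ∀ k e → e + k + 0 + k ≡ 2 * k + e
  y-exp = solve-∀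
  z-exp : ∀ k e → 2 * k + (e + k) + 0 + suc k ≡ 4 * k + 1 + e
  z-exp = solve-∀

monoΔᴱ⊛X⊛X⊛zqᵏ⊛zqᵏ⊛qᵏ⁺¹ : ∀ k → monoΔᴱ k ⊛ X ⊛ X ⊛ zqᵏ k ⊛ zqᵏ k ⊛ qᵏ⁺¹ k ≋
  mono (2 * k + 2) (2 * k + 1 + k * (2 * k + 1)) (4 * k + 3 + k * (2 * k + 1))
monoΔᴱ⊛X⊛X⊛zqᵏ⊛zqᵏ⊛qᵏ⁺¹ k = PSR.trans
  (mono-⊛-mono′ 0 (suc k) (suc k) (mono-⊛-mono′ 0 k (suc k) (mono-⊛-mono′ 0 k (suc k)
    (mono-⊛-mono′ 1 0 0 (mono-⊛-mono′ 1 0 0 (PSR.refl {monoΔᴱ k}))))))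
  (mono-cong (x-exp k) (y-exp k) (z-exp k))
  where
  x-exp : ∀ k → 2 * k + 1 + 1 + 0 + 0 + 0 ≡ 2 * k + 2
  x-exp = solve-∀
  y-exp : ∀ k → 2 * (k * k) + 0 + 0 + k + k + suc k ≡ 2 * k + 1 + k * (2 * k + 1)
  y-exp = solve-∀
  z-exp : ∀ k → 2 * k + 2 * (k * k) + 0 + 0 + suc k + suc k + suc k ≡ 4 * k + 3 + k * (2 * k + 1)
  z-exp = solve-∀

EV-row-α : ∀ k → EV-row.Tα k ≋ ⊝ fTerm k
EV-row-α k = begin
  EV-row.Δ k ⊛ αᴱ k
    ≈⟨ ⊛-congʳ (αᴱ k) (EV-row-Δ k) ⟩
  monoΔᴱ k ⊛ Pᶻ k ⊛ Pᵠ k ⊛ αᴱ k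
    ≈⟨ solve 7 (λ m p q x a b i → (m :* p :* q) :* :- (x :* x :* a :* a :* b :* i)
                                  := :- (m :* x :* x :* a :* a :* b :* (p :* i) :* q))
         PSR.refl (monoΔᴱ k) (Pᶻ k) (Pᵠ k) X (zqᵏ k) (qᵏ⁺¹ k) (geometric (zqᵏ k)) ⟩
  ⊝ (monoΔᴱ k ⊛ X ⊛ X ⊛ zqᵏ k ⊛ zqᵏ k ⊛ qᵏ⁺¹ k ⊛ (Pᶻ k ⊛ geometric (zqᵏ k)) ⊛ Pᵠ k)
    ≈⟨ PSR.-‿cong (⊛-congʳ (Pᵠ k) (PSR.*-cong (monoΔᴱ⊛X⊛X⊛zqᵏ⊛zqᵏ⊛qᵏ⁺¹ k) (Pᶻ-suc k))) ⟩
  ⊝ fTerm k  ∎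

EV-row-β : ∀ k → EV-row.Tβ k ≋ ψTerm k
EV-row-β k = begin
  EV-row.Δ k ⊛ βᴱ k
    ≈⟨ ⊛-congʳ (βᴱ k) (EV-row-Δ k) ⟩
  monoΔᴱ k ⊛ Pᶻ k ⊛ Pᵠ k ⊛ βᴱ k
    ≈⟨ solve 6 (λ m p q x a i → (m :* p :* q) :* (x :* a :* i) := m :* x :* a :* (p :* i) :* q)
         PSR.refl (monoΔᴱ k) (Pᶻ k) (Pᵠ k) X (zqᵏ k) (geometric (zqᵏ k)) ⟩
  monoΔᴱ k ⊛ X ⊛ zqᵏ k ⊛ (Pᶻ k ⊛ geometric (zqᵏ k)) ⊛ Pᵠ k
    ≈⟨ ⊛-congʳ (Pᵠ k) (PSR.*-cong (monoΔᴱ⊛X⊛zqᵏ k) (Pᶻ-suc k)) ⟩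
  ψTerm k  ∎

EV-row-γ : ∀ k → EV-row.Tγ k ≋ ⊝ φTerm k
EV-row-γ k = begin
  EV-row.Δ k ⊛ γᴱ k
    ≈⟨ ⊛-congʳ (γᴱ k) (EV-row-Δ k) ⟩
  monoΔᴱ k ⊛ Pᶻ k ⊛ Pᵠ k ⊛ γᴱ k
    ≈⟨ solve 8 (λ m p q x a b j i → (m :* p :* q) :* :- (x :* x :* a :* a :* b :* j :* i)
                  := :- (m :* x :* x :* a :* a :* b :* (p :* i) :* (q :* j)))
         PSR.refl (monoΔᴱ k) (Pᶻ k) (Pᵠ k) X (zqᵏ k) (qᵏ⁺¹ k) (geometric (qᵏ⁺¹ k)) (geometric (zqᵏ k)) ⟩
  ⊝ (monoΔᴱ k ⊛ X ⊛ X ⊛ zqᵏ k ⊛ zqᵏ k ⊛ qᵏ⁺¹ k ⊛ (Pᶻ k ⊛ geometric (zqᵏ k)) ⊛ (Pᵠ k ⊛ geometric (qᵏ⁺¹ k)))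
    ≈⟨ PSR.-‿cong (PSR.*-cong (PSR.*-cong (monoΔᴱ⊛X⊛X⊛zqᵏ⊛zqᵏ⊛qᵏ⁺¹ k) (Pᶻ-suc k)) (Pᵠ-suc k)) ⟩
  ⊝ φTerm k  ∎

EV-row-equation : EVᵘ 0 0 ≋ ⊝ fS ⊕ ODᵘ 0 0 ⊛ (⊝ ψS) ⊕ EVᵘ 0 0 ⊛ (⊝ φS)
EV-row-equation = PSR.trans EV-row.U₀≋xSum (PSR.+-cong (PSR.+-cong
  (PSR.trans (xSum-cong EV-row-α) (xSum-⊝ fTerm))
  (⊛-congˡ (ODᵘ 0 0) (PSR.trans (xSum-cong EV-row-β) (PSR.sym (⊝-involutive (xSum ψTerm))))))
  (⊛-congˡ (EVᵘ 0 0) (PSR.trans (xSum-cong EV-row-γ) (xSum-⊝ φTerm))))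

cramer : ∀ {E O f g φ φ̄ ψ ψ̄} →
  E ≋ ⊝ f ⊕ O ⊛ (⊝ ψ) ⊕ E ⊛ (⊝ φ) → O ≋ g ⊕ E ⊛ (⊝ ψ̄) ⊕ O ⊛ (⊝ φ̄) →
  let Δ = (onePS ⊕ φ) ⊛ (onePS ⊕ φ̄) ⊖ ψ ⊛ ψ̄ in
  Δ ⊛ E ≋ ⊝ ((onePS ⊕ φ̄) ⊛ f) ⊖ ψ ⊛ g × Δ ⊛ O ≋ (onePS ⊕ φ) ⊛ g ⊕ ψ̄ ⊛ f
cramer {E} {O} {f} {g} {φ} {φ̄} {ψ} {ψ̄} E-eq O-eq = Δ⊛E , Δ⊛O
  where
  Δ = (onePS ⊕ φ) ⊛ (onePS ⊕ φ̄) ⊖ ψ ⊛ ψ̄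
  rᴱ = E ⊖ (⊝ f ⊕ O ⊛ (⊝ ψ) ⊕ E ⊛ (⊝ φ))
  rᴼ = O ⊖ (g ⊕ E ⊛ (⊝ ψ̄) ⊕ O ⊛ (⊝ φ̄))
  Nᴱ = ⊝ ((onePS ⊕ φ̄) ⊛ f) ⊖ ψ ⊛ g
  Nᴼ = (onePS ⊕ φ) ⊛ g ⊕ ψ̄ ⊛ f
  Δ⊛E : Δ ⊛ E ≋ Nᴱ
  Δ⊛E = begin
    Δ ⊛ E
      ≈⟨ solve 8 (λ e o p p̄ s s̄ f g →
           ((con (+ 1) :+ p) :* (con (+ 1) :+ p̄) :- s :* s̄) :* e
           := (:- ((con (+ 1) :+ p̄) :* f) :- s :* g)
              :+ (con (+ 1) :+ p̄) :* (e :- (:- f :+ o :* (:- s) :+ e :* (:- p)))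
              :- s :* (o :- (g :+ e :* (:- s̄) :+ o :* (:- p̄))))
         PSR.refl E O φ φ̄ ψ ψ̄ f g ⟩
    Nᴱ ⊕ (onePS ⊕ φ̄) ⊛ rᴱ ⊖ ψ ⊛ rᴼ
      ≈⟨ PSR.+-cong (⊕-congˡ Nᴱ (⊛-congˡ (onePS ⊕ φ̄) (residual-zero E-eq)))
                    (PSR.-‿cong (⊛-congˡ ψ (residual-zero O-eq))) ⟩
    Nᴱ ⊕ (onePS ⊕ φ̄) ⊛ zeroPS ⊖ ψ ⊛ zeroPS
      ≈⟨ solve 3 (λ n a b → n :+ a :* con (+ 0) :- b :* con (+ 0) := n) PSR.refl Nᴱ (onePS ⊕ φ̄) ψ ⟩
    Nᴱ  ∎
  Δ⊛O : Δ ⊛ O ≋ Nᴼ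
  Δ⊛O = begin
    Δ ⊛ O
      ≈⟨ solve 8 (λ e o p p̄ s s̄ f g →
           ((con (+ 1) :+ p) :* (con (+ 1) :+ p̄) :- s :* s̄) :* o
           := ((con (+ 1) :+ p) :* g :+ s̄ :* f)
              :+ (con (+ 1) :+ p) :* (o :- (g :+ e :* (:- s̄) :+ o :* (:- p̄)))
              :- s̄ :* (e :- (:- f :+ o :* (:- s) :+ e :* (:- p))))
         PSR.refl E O φ φ̄ ψ ψ̄ f g ⟩
    Nᴼ ⊕ (onePS ⊕ φ) ⊛ rᴼ ⊖ ψ̄ ⊛ rᴱ
      ≈⟨ PSR.+-cong (⊕-congˡ Nᴼ (⊛-congˡ (onePS ⊕ φ) (residual-zero O-eq)))
                    (PSR.-‿cong (⊛-congˡ ψ̄ (residual-zero E-eq))) ⟩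
    Nᴼ ⊕ (onePS ⊕ φ) ⊛ zeroPS ⊖ ψ̄ ⊛ zeroPS
      ≈⟨ solve 3 (λ n a b → n :+ a :* con (+ 0) :- b :* con (+ 0) := n) PSR.refl Nᴼ (onePS ⊕ φ) ψ̄ ⟩
    Nᴼ  ∎

theorem4p4 : (EV1 ≈ inv ΔS ⊛ (⊝ ((onePS ⊕ swapYZ φS) ⊛ fS) ⊖ ψS ⊛ gS))
    × (OD1 ≈ inv ΔS ⊛ ((onePS ⊕ φS) ⊛ gS ⊕ swapYZ ψS ⊛ fS))
theorem4p4 = unwrap (PSR.trans EV1≋EVᵘ (solve-by-inv ΔS refl (proj₁ cramer-system)))
           , unwrap (PSR.trans OD1≋ODᵘ (solve-by-inv ΔS refl (proj₂ cramer-system)))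
  where
  cramer-system = cramer {f = fS} {gS} {φS} {swapYZ φS} {ψS} {swapYZ ψS} EV-row-equation OD-row-equation
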